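{- Let $v>1$ be an admissible integer and $t>0$ an integer with $2^t-1<v$. There exists a Steiner triple system of order $v$ having at least $2^t-1$ Veblen points if and only if $\frac{v+1}{2^t}$ is an integer congruent to $2$ or $4$ modulo $6$.
   Context: A Steiner triple system (STS) of order $v$ is a set of $v$ points with a family of 3-subsets (triples) such that every 2-subset lies in exactly one triple; an integer is admissible if it is the order of an STS, i.e. it is congruent to $1$ or $3$ modulo $6$. A point $x$ is a Veblen point if whenever $\{x,a,b\},\{x,c,d\},\{y,a,c\}$ are triples, also $\{y,b,d\}$ is a triple. -}

module Defs where

open import Data.Nat using (ℕ; _%_; _∸_; _^_)
open import Data.Fin using (Fin)
open import Data.Fin.Properties using (_≟_)
open import Data.Product using (_×_; _,_; ∃)
open import Data.Sum using (_⊎_)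
open import Data.List using (List; filter; length)
open import Data.List.Relation.Unary.Any using (Any)
open import Relation.Binary.PropositionalEquality using (_≡_)
open import Relation.Nullary using (¬_; Dec)
open import Relation.Nullary.Decidable using (_⊎-dec_; _×-dec_)
open import Function.Definitions using (Injective)

Admissible : ℕ → Set
Admissible v = (v % 6 ≡ 1) ⊎ (v % 6 ≡ 3)

-- a triple on the point set Fin v (its underlying 3-subset is {a, b, c})
Triple : ℕ → Set
Triple v = Fin v × Fin v × Fin v

_∈ₜ_ : ∀ {v} → Fin v → Triple v → Set
x ∈ₜ (a , b , c) = (x ≡ a) ⊎ (x ≡ b) ⊎ (x ≡ c)

_∈ₜ?_ : ∀ {v} (x : Fin v) (t : Triple v) → Dec (x ∈ₜ t)
x ∈ₜ? (a , b , c) = (x ≟ a) ⊎-dec ((x ≟ b) ⊎-dec (x ≟ c))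

Proper : ∀ {v} → Triple v → Set
Proper (a , b , c) = ¬ a ≡ b × ¬ a ≡ c × ¬ b ≡ c

pairCount : ∀ {v} → List (Triple v) → Fin v → Fin v → ℕ
pairCount B x y = length (filter (λ t → (x ∈ₜ? t) ×-dec (y ∈ₜ? t)) B)

record IsSTS {v : ℕ} (B : List (Triple v)) : Set where
  field
    proper : ∀ t → Any (t ≡_) B → Proper t
    unique : ∀ x y → ¬ x ≡ y → pairCount B x y ≡ 1

IsBlock : ∀ {v} → List (Triple v) → Fin v → Fin v → Fin v → Set
IsBlock B p q r =
  ¬ p ≡ q × ¬ p ≡ r × ¬ q ≡ r × Any (λ t → p ∈ₜ t × q ∈ₜ t × r ∈ₜ t) B

IsVeblen : ∀ {v} → List (Triple v) → Fin v → Set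
IsVeblen B x = ∀ y a b c d →
  IsBlock B x a b → IsBlock B x c d → IsBlock B y a c → IsBlock B y b d

AtLeastVeblen : ∀ {v} → List (Triple v) → ℕ → Set
AtLeastVeblen {v} B n =
  ∃ λ (f : Fin n → Fin v) → Injective _≡_ _≡_ f × (∀ i → IsVeblen B (f i))

{-# OPTIONS --safe #-}
-- A Steiner triple system is the same thing as a Steiner quasigroup, x · y being the third point
-- of the block through x and y.  If x is a Veblen point, the lines through x are the points of a
-- quotient system of order (v - 1) / 2, and every other Veblen point u maps to a Veblen point
-- {u , x · u} of it, at most two of them to the same one.  By induction on t, 2 ^ t - 1 Veblen
-- points force 2 ^ (t + 1) ∣ v + 1, so (v + 1) / 2 ^ t is even; it is prime to 3 as v is admissible.
-- Conversely the doubling v ↦ 2 v + 1 turns a system with u Veblen points into one with 2 u + 1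
-- (the new point and both copies of each old one).  Starting from a system of the admissible
-- order k - 1, given by the constructions of Bose and Skolem, t doublings reach k 2 ^ t - 1.
module Submission where

open import Defs
open import Data.Nat using (ℕ; NonZero)
open import Data.Fin using (Fin)
open import Data.List using (List)
open import Data.Product using (_×_; _,_; proj₁; proj₂; ∃)
open import Data.Sum using (_⊎_; inj₁; inj₂)
open import Data.Empty using (⊥; ⊥-elim)
open import Data.Bool using (Bool; true; false)
open import Data.Maybe using (Maybe; just; nothing)
open import Function using (_∘_)
open import Function.Bundles using (_↔_; Inverse; _⇔_; mk⇔)
open import Relation.Nullary using (¬_; Dec; yes; no)
open import Relation.Binary.PropositionalEquality
open import Relation.Binary.Definitions using (DecidableEquality)

module SteinerQuasigroups where


  record SteinerQuasigroup (P : Set) : Set where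
    infixl 7 _·_
    field
      _·_ : P → P → P
      idem : ∀ x → x · x ≡ x
      comm : ∀ x y → x · y ≡ y · x
      inv : ∀ x y → x · (x · y) ≡ y

    invʳ : ∀ x y → (x · y) · y ≡ x
    invʳ x y = begin
      (x · y) · y ≡⟨ comm (x · y) y ⟩
      y · (x · y) ≡⟨ cong (y ·_) (comm x y) ⟩
      y · (y · x) ≡⟨ inv y x ⟩
      x           ∎
      where open ≡-Reasoning

    cancelˡ : ∀ {x y z} → x · y ≡ x · z → y ≡ z
    cancelˡ {x} {y} {z} e = trans (sym (inv x y)) (trans (cong (x ·_) e) (inv x z))

    ·-≢ˡ : ∀ {x y} → x ≢ y → x · y ≢ x
    ·-≢ˡ {x} x≢y e = x≢y (sym (cancelˡ (trans e (sym (idem x)))))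

    ·-≢ʳ : ∀ {x y} → x ≢ y → x · y ≢ y
    ·-≢ʳ {x} {y} x≢y e = ·-≢ˡ (x≢y ∘ sym) (trans (comm y x) e)

    inv-comm : ∀ x y → y · (x · y) ≡ x
    inv-comm x y = trans (cong (y ·_) (comm x y)) (inv y x)

    collinear-swap₁₂ : ∀ {x y z} → z ≡ x · y → z ≡ y · x
    collinear-swap₁₂ {x} {y} e = trans e (comm x y)

    collinear-swap₂₃ : ∀ {x y z} → z ≡ x · y → y ≡ x · z
    collinear-swap₂₃ {x} {y} refl = sym (inv x y)

  module _ {P : Set} (Q : SteinerQuasigroup P) where
    open SteinerQuasigroup Q

    -- With b = x · a, d = x · c and y = a · c this is the defining property of a
    -- Veblen point; the hypotheses exclude the degenerate configurations.
    IsVeblenPoint : P → Set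
    IsVeblenPoint x = ∀ a c → a ≢ x → c ≢ x → a ≢ c → c ≢ x · a →
      (a · c) · (x · a) ≡ x · c

open SteinerQuasigroups


module Triples where


  private
    variable
      v : ℕ
      a b c x y z w : Fin v

  private
    ∈ₜ-other₁ : z ∈ₜ (a , b , c) → z ≢ b → z ≢ c → z ≡ a
    ∈ₜ-other₁ (inj₁ e) _ _ = e
    ∈ₜ-other₁ (inj₂ (inj₁ e)) z≢b _ = ⊥-elim (z≢b e)
    ∈ₜ-other₁ (inj₂ (inj₂ e)) _ z≢c = ⊥-elim (z≢c e)

    ∈ₜ-other₂ : z ∈ₜ (a , b , c) → z ≢ a → z ≢ c → z ≡ b
    ∈ₜ-other₂ (inj₁ e) z≢a _ = ⊥-elim (z≢a e)
    ∈ₜ-other₂ (inj₂ (inj₁ e)) _ _ = e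
    ∈ₜ-other₂ (inj₂ (inj₂ e)) _ z≢c = ⊥-elim (z≢c e)

    ∈ₜ-other₃ : z ∈ₜ (a , b , c) → z ≢ a → z ≢ b → z ≡ c
    ∈ₜ-other₃ (inj₁ e) z≢a _ = ⊥-elim (z≢a e)
    ∈ₜ-other₃ (inj₂ (inj₁ e)) _ z≢b = ⊥-elim (z≢b e)
    ∈ₜ-other₃ (inj₂ (inj₂ e)) _ _ = e

  third-unique : ∀ (t : Triple v) → x ∈ₜ t → y ∈ₜ t → x ≢ y →
    z ∈ₜ t → z ≢ x → z ≢ y → w ∈ₜ t → w ≢ x → w ≢ y → z ≡ w
  third-unique _ (inj₁ refl) (inj₁ refl) x≢y _ _ _ _ _ _ = ⊥-elim (x≢y refl)
  third-unique _ (inj₂ (inj₁ refl)) (inj₂ (inj₁ refl)) x≢y _ _ _ _ _ _ = ⊥-elim (x≢y refl)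
  third-unique _ (inj₂ (inj₂ refl)) (inj₂ (inj₂ refl)) x≢y _ _ _ _ _ _ = ⊥-elim (x≢y refl)
  third-unique _ (inj₁ refl) (inj₂ (inj₁ refl)) _ z∈ z≢x z≢y w∈ w≢x w≢y =
    trans (∈ₜ-other₃ z∈ z≢x z≢y) (sym (∈ₜ-other₃ w∈ w≢x w≢y))
  third-unique _ (inj₂ (inj₁ refl)) (inj₁ refl) _ z∈ z≢x z≢y w∈ w≢x w≢y =
    trans (∈ₜ-other₃ z∈ z≢y z≢x) (sym (∈ₜ-other₃ w∈ w≢y w≢x))
  third-unique _ (inj₁ refl) (inj₂ (inj₂ refl)) _ z∈ z≢x z≢y w∈ w≢x w≢y =
    trans (∈ₜ-other₂ z∈ z≢x z≢y) (sym (∈ₜ-other₂ w∈ w≢x w≢y))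
  third-unique _ (inj₂ (inj₂ refl)) (inj₁ refl) _ z∈ z≢x z≢y w∈ w≢x w≢y =
    trans (∈ₜ-other₂ z∈ z≢y z≢x) (sym (∈ₜ-other₂ w∈ w≢y w≢x))
  third-unique _ (inj₂ (inj₁ refl)) (inj₂ (inj₂ refl)) _ z∈ z≢x z≢y w∈ w≢x w≢y =
    trans (∈ₜ-other₁ z∈ z≢x z≢y) (sym (∈ₜ-other₁ w∈ w≢x w≢y))
  third-unique _ (inj₂ (inj₂ refl)) (inj₂ (inj₁ refl)) _ z∈ z≢x z≢y w∈ w≢x w≢y =
    trans (∈ₜ-other₁ z∈ z≢y z≢x) (sym (∈ₜ-other₁ w∈ w≢y w≢x))

  third : ∀ (t : Triple v) → Proper t → x ∈ₜ t → y ∈ₜ t → x ≢ y →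
    ∃ λ z → z ∈ₜ t × z ≢ x × z ≢ y
  third _ _ (inj₁ refl) (inj₁ refl) x≢y = ⊥-elim (x≢y refl)
  third _ _ (inj₂ (inj₁ refl)) (inj₂ (inj₁ refl)) x≢y = ⊥-elim (x≢y refl)
  third _ _ (inj₂ (inj₂ refl)) (inj₂ (inj₂ refl)) x≢y = ⊥-elim (x≢y refl)
  third (_ , _ , c) (_ , a≢c , b≢c) (inj₁ refl) (inj₂ (inj₁ refl)) _ =
    c , inj₂ (inj₂ refl) , a≢c ∘ sym , b≢c ∘ sym
  third (_ , _ , c) (_ , a≢c , b≢c) (inj₂ (inj₁ refl)) (inj₁ refl) _ =
    c , inj₂ (inj₂ refl) , b≢c ∘ sym , a≢c ∘ sym
  third (_ , b , _) (a≢b , _ , b≢c) (inj₁ refl) (inj₂ (inj₂ refl)) _ = b , inj₂ (inj₁ refl) , a≢b ∘ sym , b≢c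
  third (_ , b , _) (a≢b , _ , b≢c) (inj₂ (inj₂ refl)) (inj₁ refl) _ = b , inj₂ (inj₁ refl) , b≢c , a≢b ∘ sym
  third (a , _ , _) (a≢b , a≢c , _) (inj₂ (inj₁ refl)) (inj₂ (inj₂ refl)) _ = a , inj₁ refl , a≢b , a≢c
  third (a , _ , _) (a≢b , a≢c , _) (inj₂ (inj₂ refl)) (inj₂ (inj₁ refl)) _ = a , inj₁ refl , a≢c , a≢b


module SingletonLists {A : Set} where

  open import Data.List using ([]; _∷_; length)
  open import Data.List.Relation.Unary.Any using (here; there)
  open import Data.List.Relation.Unary.All using (_∷_)
  open import Data.List.Relation.Unary.AllPairs using (_∷_)
  open import Data.List.Relation.Unary.Unique.Propositional using (Unique)
  open import Data.List.Membership.Propositional using (_∈_)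

  private
    variable
      a b s : A
      ys : List A

  length≡1⇒∃∈ : length ys ≡ 1 → ∃ (_∈ ys)
  length≡1⇒∃∈ {u ∷ _} _ = u , here refl

  length≡1⇒∈-unique : length ys ≡ 1 → a ∈ ys → b ∈ ys → a ≡ b
  length≡1⇒∈-unique {_ ∷ []} _ (here refl) (here refl) = refl

  unique-constant⇒length≡1 : Unique ys → s ∈ ys → (∀ {a} → a ∈ ys → a ≡ s) → length ys ≡ 1
  unique-constant⇒length≡1 {_ ∷ []} _ _ _ = refl
  unique-constant⇒length≡1 {_ ∷ _ ∷ _} ((a≢b ∷ _) ∷ _) _ ≡s =
    ⊥-elim (a≢b (trans (≡s (here refl)) (sym (≡s (there (here refl))))))


module FromSTS {v : ℕ} (B : List (Triple v)) (sts : IsSTS B) where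

  open IsSTS sts
  open Triples
  open SingletonLists
  open import Data.Fin.Properties using (_≟_)
  import Data.List.Relation.Unary.Any as Any
  open import Data.List.Membership.Propositional using (find; lose)
  open import Data.List.Membership.Propositional.Properties using (∈-filter⁺; ∈-filter⁻)
  open import Relation.Nullary.Decidable using (_×-dec_)
  open import Relation.Unary using (Decidable)

  private
    variable
      x y z w : Fin v

    through? : ∀ (x y : Fin v) → Decidable (λ t → x ∈ₜ t × y ∈ₜ t)
    through? x y t = (x ∈ₜ? t) ×-dec (y ∈ₜ? t)

  block-exists : x ≢ y → ∃ (IsBlock B x y)
  block-exists {x} {y} x≢y =
    let t , t∈ = length≡1⇒∃∈ (unique x y x≢y)
        t∈B , x∈t , y∈t = ∈-filter⁻ (through? x y) {xs = B} t∈
        z , z∈t , z≢x , z≢y = third t (proper t t∈B) x∈t y∈t x≢y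
    in z , x≢y , z≢x ∘ sym , z≢y ∘ sym , lose t∈B (x∈t , y∈t , z∈t)

  block-unique : IsBlock B x y z → IsBlock B x y w → z ≡ w
  block-unique {x} {y} {z} {w} (x≢y , x≢z , y≢z , z-block) (_ , x≢w , y≢w , w-block) =
    let t , t∈B , x∈t , y∈t , z∈t = find z-block
        t′ , t′∈B , x∈t′ , y∈t′ , w∈t′ = find w-block
        t≡t′ = length≡1⇒∈-unique (unique x y x≢y)
                 (∈-filter⁺ (through? x y) t∈B (x∈t , y∈t)) (∈-filter⁺ (through? x y) t′∈B (x∈t′ , y∈t′))
    in third-unique t x∈t y∈t x≢y z∈t (x≢z ∘ sym) (y≢z ∘ sym)
         (subst (w ∈ₜ_) (sym t≡t′) w∈t′) (x≢w ∘ sym) (y≢w ∘ sym)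

  IsBlock-swap₁₂ : IsBlock B x y z → IsBlock B y x z
  IsBlock-swap₁₂ (x≢y , x≢z , y≢z , block) =
    x≢y ∘ sym , y≢z , x≢z , Any.map (λ (x∈ , y∈ , z∈) → y∈ , x∈ , z∈) block

  IsBlock-swap₂₃ : IsBlock B x y z → IsBlock B x z y
  IsBlock-swap₂₃ (x≢y , x≢z , y≢z , block) =
    x≢z , x≢y , y≢z ∘ sym , Any.map (λ (x∈ , y∈ , z∈) → x∈ , z∈ , y∈) block

  _·_ : Fin v → Fin v → Fin v
  x · y with x ≟ y
  ... | yes _ = x
  ... | no x≢y = proj₁ (block-exists x≢y)

  ·-block : x ≢ y → IsBlock B x y (x · y)
  ·-block {x} {y} x≢y with x ≟ y
  ... | yes x≡y = ⊥-elim (x≢y x≡y)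
  ... | no x≢y = proj₂ (block-exists x≢y)

  block⇒≡· : IsBlock B x y z → z ≡ x · y
  block⇒≡· b = block-unique b (·-block (proj₁ b))

  quasigroup : SteinerQuasigroup (Fin v)
  quasigroup = record { _·_ = _·_ ; idem = idem ; comm = comm ; inv = inv }
    where
    idem : ∀ x → x · x ≡ x
    idem x with x ≟ x
    ... | yes _ = refl
    ... | no x≢x = ⊥-elim (x≢x refl)

    comm : ∀ x y → x · y ≡ y · x
    comm x y with x ≟ y
    ... | yes refl = sym (idem x)
    ... | no x≢y = block⇒≡· (IsBlock-swap₁₂ (proj₂ (block-exists x≢y)))

    inv : ∀ x y → x · (x · y) ≡ y
    inv x y with x ≟ y
    ... | yes refl = idem x
    ... | no x≢y = sym (block⇒≡· (IsBlock-swap₂₃ (proj₂ (block-exists x≢y))))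

  veblen : IsVeblen B x → IsVeblenPoint quasigroup x
  veblen {x} veb a c a≢x c≢x a≢c _ =
    sym (block⇒≡· (veb (a · c) a (x · a) c (x · c)
      (·-block (a≢x ∘ sym)) (·-block (c≢x ∘ sym)) (IsBlock-swap₁₂ (IsBlock-swap₂₃ (·-block a≢c)))))


module ToSTS {v : ℕ} (Q : SteinerQuasigroup (Fin v)) where

  open SteinerQuasigroup Q
  open Triples
  open SingletonLists
  open import Data.Fin using (_<_; _≤_; _<?_)
  open import Data.Fin.Properties using (_≟_; <-cmp; ≤-antisym; <-asym; <-trans; <⇒≢; ≤-refl)
  open import Data.Nat.Properties using (<⇒≤)
  open import Data.List using (filter; cartesianProduct; allFin)
  open import Data.List.Relation.Unary.Unique.Propositional using (Unique)
  import Data.List.Relation.Unary.Unique.Propositional.Properties as Unique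
  open import Data.List.Membership.Propositional using (_∈_; find; lose)
  open import Data.List.Membership.Propositional.Properties
    using (∈-filter⁺; ∈-filter⁻; ∈-cartesianProduct⁺; ∈-allFin)
  open import Relation.Binary using (tri<; tri≈; tri>)
  open import Relation.Nullary.Decidable using (_×-dec_)
  open import Relation.Unary using (Decidable)

  private
    variable
      x y z p q r : Fin v
      t t′ : Triple v

  Sorted : Triple v → Set
  Sorted (a , b , c) = a < b × b < c × c ≡ a · b

  Sorted? : Decidable Sorted
  Sorted? (a , b , c) = (a <? b) ×-dec (b <? c) ×-dec (c ≟ a · b)

  allTriples : List (Triple v)
  allTriples = cartesianProduct (allFin v) (cartesianProduct (allFin v) (allFin v))

  blocks : List (Triple v)
  blocks = filter Sorted? allTriples

  blocks-unique : Unique blocks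
  blocks-unique = Unique.filter⁺ Sorted?
    (Unique.cartesianProduct⁺ (Unique.allFin⁺ v) (Unique.cartesianProduct⁺ (Unique.allFin⁺ v) (Unique.allFin⁺ v)))

  sorted⇒∈blocks : Sorted t → t ∈ blocks
  sorted⇒∈blocks {a , b , c} =
    ∈-filter⁺ Sorted? (∈-cartesianProduct⁺ (∈-allFin a) (∈-cartesianProduct⁺ (∈-allFin b) (∈-allFin c)))

  ∈blocks⇒sorted : t ∈ blocks → Sorted t
  ∈blocks⇒sorted t∈ = proj₂ (∈-filter⁻ Sorted? {xs = allTriples} t∈)

  sorted⇒proper : Sorted t → Proper t
  sorted⇒proper (a<b , b<c , _) = <⇒≢ a<b , <⇒≢ (<-trans a<b b<c) , <⇒≢ b<c

  ·-∈ₜ : Sorted t → x ∈ₜ t → y ∈ₜ t → x ≢ y → (x · y) ∈ₜ t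
  ·-∈ₜ _ (inj₁ refl) (inj₁ refl) x≢y = ⊥-elim (x≢y refl)
  ·-∈ₜ _ (inj₂ (inj₁ refl)) (inj₂ (inj₁ refl)) x≢y = ⊥-elim (x≢y refl)
  ·-∈ₜ _ (inj₂ (inj₂ refl)) (inj₂ (inj₂ refl)) x≢y = ⊥-elim (x≢y refl)
  ·-∈ₜ (_ , _ , c≡ab) (inj₁ refl) (inj₂ (inj₁ refl)) _ = inj₂ (inj₂ (sym c≡ab))
  ·-∈ₜ (_ , _ , c≡ab) (inj₂ (inj₁ refl)) (inj₁ refl) _ = inj₂ (inj₂ (sym (collinear-swap₁₂ c≡ab)))
  ·-∈ₜ (_ , _ , c≡ab) (inj₁ refl) (inj₂ (inj₂ refl)) _ = inj₂ (inj₁ (sym (collinear-swap₂₃ c≡ab)))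
  ·-∈ₜ (_ , _ , c≡ab) (inj₂ (inj₂ refl)) (inj₁ refl) _ =
    inj₂ (inj₁ (sym (collinear-swap₁₂ (collinear-swap₂₃ c≡ab))))
  ·-∈ₜ (_ , _ , c≡ab) (inj₂ (inj₁ refl)) (inj₂ (inj₂ refl)) _ =
    inj₁ (sym (collinear-swap₂₃ (collinear-swap₁₂ c≡ab)))
  ·-∈ₜ (_ , _ , c≡ab) (inj₂ (inj₂ refl)) (inj₂ (inj₁ refl)) _ =
    inj₁ (sym (collinear-swap₁₂ (collinear-swap₂₃ (collinear-swap₁₂ c≡ab))))

  sorted-collinear : Sorted t → p ∈ₜ t → q ∈ₜ t → r ∈ₜ t → p ≢ q → r ≢ p → r ≢ q → r ≡ p · q
  sorted-collinear {t} s p∈ q∈ r∈ p≢q r≢p r≢q =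
    third-unique t p∈ q∈ p≢q r∈ r≢p r≢q (·-∈ₜ s p∈ q∈ p≢q) (·-≢ˡ p≢q) (·-≢ʳ p≢q)

  sorted-members : ∀ {x y z} → Sorted t → x ∈ₜ t → y ∈ₜ t → x ≢ y → z ∈ₜ t → z ∈ₜ (x , y , x · y)
  sorted-members {x = x} {y} {z} s x∈ y∈ x≢y z∈ with z ≟ x | z ≟ y
  ... | yes z≡x | _ = inj₁ z≡x
  ... | no _ | yes z≡y = inj₂ (inj₁ z≡y)
  ... | no z≢x | no z≢y = inj₂ (inj₂ (sorted-collinear s x∈ y∈ z∈ x≢y z≢x z≢y))

  ·-members-sorted : Sorted t → x ∈ₜ t → y ∈ₜ t → x ≢ y → z ∈ₜ (x , y , x · y) → z ∈ₜ t
  ·-members-sorted _ x∈ _ _ (inj₁ refl) = x∈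
  ·-members-sorted _ _ y∈ _ (inj₂ (inj₁ refl)) = y∈
  ·-members-sorted s x∈ y∈ x≢y (inj₂ (inj₂ refl)) = ·-∈ₜ s x∈ y∈ x≢y

  sort : r ≡ p · q → p ≢ q → p ≢ r → q ≢ r → ∃ λ t → Sorted t × p ∈ₜ t × q ∈ₜ t × r ∈ₜ t
  sort {r} {p} {q} e p≢q p≢r q≢r with <-cmp p q | <-cmp q r | <-cmp p r
  ... | tri≈ _ p≡q _ | _ | _ = ⊥-elim (p≢q p≡q)
  ... | _ | tri≈ _ q≡r _ | _ = ⊥-elim (q≢r q≡r)
  ... | _ | _ | tri≈ _ p≡r _ = ⊥-elim (p≢r p≡r)
  ... | tri< p<q _ _ | tri< q<r _ _ | _ =
    (p , q , r) , (p<q , q<r , e) , inj₁ refl , inj₂ (inj₁ refl) , inj₂ (inj₂ refl)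
  ... | tri< _ _ _ | tri> _ _ r<q | tri< p<r _ _ =
    (p , r , q) , (p<r , r<q , collinear-swap₂₃ e) , inj₁ refl , inj₂ (inj₂ refl) , inj₂ (inj₁ refl)
  ... | tri< p<q _ _ | tri> _ _ _ | tri> _ _ r<p =
    (r , p , q) , (r<p , p<q , collinear-swap₁₂ (collinear-swap₂₃ e)) ,
    inj₂ (inj₁ refl) , inj₂ (inj₂ refl) , inj₁ refl
  ... | tri> _ _ q<p | tri< _ _ _ | tri< p<r _ _ =
    (q , p , r) , (q<p , p<r , collinear-swap₁₂ e) , inj₂ (inj₁ refl) , inj₁ refl , inj₂ (inj₂ refl)
  ... | tri> _ _ _ | tri< q<r _ _ | tri> _ _ r<p =
    (q , r , p) , (q<r , r<p , collinear-swap₂₃ (collinear-swap₁₂ e)) ,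
    inj₂ (inj₂ refl) , inj₁ refl , inj₂ (inj₁ refl)
  ... | tri> _ _ q<p | tri> _ _ r<q | _ =
    (r , q , p) , (r<q , q<p , collinear-swap₁₂ (collinear-swap₂₃ (collinear-swap₁₂ e))) ,
    inj₂ (inj₂ refl) , inj₂ (inj₁ refl) , inj₁ refl

  private
    first-≤ : Sorted t → z ∈ₜ t → proj₁ t ≤ z
    first-≤ _ (inj₁ refl) = ≤-refl
    first-≤ (a<b , _) (inj₂ (inj₁ refl)) = <⇒≤ a<b
    first-≤ (a<b , b<c , _) (inj₂ (inj₂ refl)) = <⇒≤ (<-trans a<b b<c)

  sorted-unique : Sorted t → Sorted t′ →
    (∀ {z} → z ∈ₜ t → z ∈ₜ t′) → (∀ {z} → z ∈ₜ t′ → z ∈ₜ t) → t ≡ t′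
  sorted-unique {a , b , c} {a′ , b′ , c′} s s′ t⊆t′ t′⊆t
    with ≤-antisym (first-≤ s (t′⊆t (inj₁ refl))) (first-≤ s′ (t⊆t′ (inj₁ refl)))
  sorted-unique {a , b , c} {a , b′ , c′} (a<b , b<c , c≡ab) (_ , b′<c′ , c′≡ab′) t⊆t′ _ | refl
    with t⊆t′ (inj₂ (inj₁ refl))
  ... | inj₁ b≡a = ⊥-elim (<⇒≢ a<b (sym b≡a))
  ... | inj₂ (inj₁ refl) = cong (λ w → a , b , w) (trans c≡ab (sym c′≡ab′))
  ... | inj₂ (inj₂ refl) = ⊥-elim (<-asym b<c (subst (_< b) (trans (collinear-swap₂₃ c′≡ab′) (sym c≡ab)) b′<c′))

  isSTS : IsSTS blocks
  isSTS = record { proper = λ t t∈ → sorted⇒proper (∈blocks⇒sorted t∈) ; unique = unique }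
    where
    unique : ∀ x y → x ≢ y → pairCount blocks x y ≡ 1
    unique x y x≢y with sort refl x≢y (·-≢ˡ x≢y ∘ sym) (·-≢ʳ x≢y ∘ sym)
    ... | s , s-sorted , x∈s , y∈s , _ =
      unique-constant⇒length≡1 (Unique.filter⁺ through? blocks-unique)
        (∈-filter⁺ through? (sorted⇒∈blocks s-sorted) (x∈s , y∈s)) ≡s
      where
      through? : Decidable (λ t → x ∈ₜ t × y ∈ₜ t)
      through? t = (x ∈ₜ? t) ×-dec (y ∈ₜ? t)
      ≡s : ∀ {t} → t ∈ filter through? blocks → t ≡ s
      ≡s t∈ =
        let t∈B , x∈t , y∈t = ∈-filter⁻ through? {xs = blocks} t∈
            t-sorted = ∈blocks⇒sorted t∈B
        in sorted-unique t-sorted s-sorted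
             (·-members-sorted s-sorted x∈s y∈s x≢y ∘ sorted-members t-sorted x∈t y∈t x≢y)
             (·-members-sorted t-sorted x∈t y∈t x≢y ∘ sorted-members s-sorted x∈s y∈s x≢y)

  collinear⇒block : p ≢ q → p ≢ r → q ≢ r → r ≡ p · q → IsBlock blocks p q r
  collinear⇒block p≢q p≢r q≢r e =
    let t , t-sorted , p∈ , q∈ , r∈ = sort e p≢q p≢r q≢r
    in p≢q , p≢r , q≢r , lose (sorted⇒∈blocks t-sorted) (p∈ , q∈ , r∈)

  block⇒collinear : IsBlock blocks p q r → r ≡ p · q
  block⇒collinear (p≢q , p≢r , q≢r , block) =
    let t , t∈ , p∈ , q∈ , r∈ = find block
    in sorted-collinear (∈blocks⇒sorted t∈) p∈ q∈ r∈ p≢q (p≢r ∘ sym) (q≢r ∘ sym)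

  veblen : IsVeblenPoint Q x → IsVeblen blocks x
  veblen {x} veb y a b c d xab xcd yac = collinear⇒block y≢b y≢d b≢d d≡yb
    where
    b≡xa = block⇒collinear xab
    d≡xc = block⇒collinear xcd
    c≡ya = block⇒collinear yac
    y≡ac : y ≡ a · c
    y≡ac = collinear-swap₂₃ (collinear-swap₁₂ c≡ya)
    x≢a = proj₁ xab
    x≢c = proj₁ xcd
    a≢c = proj₁ (proj₂ (proj₂ yac))
    y≢b : y ≢ b
    y≢b refl = x≢c (sym (trans c≡ya (trans (cong (_· a) b≡xa) (invʳ x a))))
    y≢d : y ≢ d
    y≢d refl = x≢a (sym (trans (collinear-swap₂₃ c≡ya) (trans (cong (_· c) d≡xc) (invʳ x c))))
    b≢d : b ≢ d
    b≢d b≡d = a≢c (cancelˡ (trans (sym b≡xa) (trans b≡d d≡xc)))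
    d≡yb : d ≡ y · b
    d≡yb with c ≟ x · a
    ... | no c≢xa = trans d≡xc (sym (trans (cong₂ _·_ y≡ac b≡xa) (veb a c (x≢a ∘ sym) (x≢c ∘ sym) a≢c c≢xa)))
    ... | yes c≡xa = trans d≡xc (cong₂ _·_ (sym y≡x) (trans c≡xa (sym b≡xa)))
      where
      y≡x : y ≡ x
      y≡x = trans y≡ac (trans (cong (a ·_) c≡xa) (inv-comm x a))


module Counting where

  open import Data.Nat using (zero; suc; _+_; _≤_; z≤n; s≤s)
  open import Data.Nat.Properties using (+-mono-≤; ≤-antisym; +-suc)
  open import Data.Fin using (zero; suc)
  open import Data.Fin.Properties using (_≟_; suc-injective)
  open import Level using (0ℓ)
  open import Relation.Unary using (Pred; Decidable; _⊆_)
  open import Relation.Unary.Properties using (U?; _∩?_; ∁?)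

  private
    variable
      N M : ℕ
      P R : Pred (Fin N) 0ℓ

  indicator : ∀ {A : Set} → Dec A → ℕ
  indicator (yes _) = 1
  indicator (no _) = 0

  count : Decidable P → ℕ
  count {zero} _ = 0
  count {suc N} P? = indicator (P? zero) + count (P? ∘ suc)

  count-mono : ∀ (P? : Decidable P) (R? : Decidable R) → P ⊆ R → count P? ≤ count R?
  count-mono {zero} _ _ _ = z≤n
  count-mono {suc N} P? R? P⊆R =
    +-mono-≤ (indicator-mono (P? zero) (R? zero) P⊆R) (count-mono (P? ∘ suc) (R? ∘ suc) P⊆R)
    where
    indicator-mono : ∀ {A B : Set} (a : Dec A) (b : Dec B) → (A → B) → indicator a ≤ indicator b
    indicator-mono (yes a) (yes _) _ = s≤s z≤n
    indicator-mono (yes a) (no ¬b) f = ⊥-elim (¬b (f a))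
    indicator-mono (no _) _ _ = z≤n

  count-cong : ∀ (P? : Decidable P) (R? : Decidable R) → P ⊆ R → R ⊆ P → count P? ≡ count R?
  count-cong P? R? P⊆R R⊆P = ≤-antisym (count-mono P? R? P⊆R) (count-mono R? P? R⊆P)

  count-split : ∀ (P? : Decidable P) (R? : Decidable R) → count P? ≡ count (P? ∩? R?) + count (P? ∩? ∁? R?)
  count-split {zero} _ _ = refl
  count-split {suc N} P? R? with P? zero | R? zero
  ... | yes _ | yes _ = cong suc (count-split (P? ∘ suc) (R? ∘ suc))
  ... | yes _ | no _ = trans (cong suc (count-split (P? ∘ suc) (R? ∘ suc))) (sym (+-suc _ _))
  ... | no _ | _ = count-split (P? ∘ suc) (R? ∘ suc)

  count-U : count {N} U? ≡ N
  count-U {zero} = refl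
  count-U {suc N} = cong suc count-U

  count>0⇒∃ : ∀ (P? : Decidable P) → 1 ≤ count P? → ∃ P
  count>0⇒∃ {suc N} P? 1≤count with P? zero
  ... | yes p = zero , p
  ... | no _ = let i , p = count>0⇒∃ (P? ∘ suc) 1≤count in suc i , p

  private
    count-remove-shift : ∀ (P? : Decidable P) {j} →
      count ((P? ∘ suc) ∩? ∁? (_≟ j)) ≡ count ((P? ∩? ∁? (_≟ suc j)) ∘ suc)
    count-remove-shift P? {j} = count-cong ((P? ∘ suc) ∩? ∁? (_≟ j)) ((P? ∩? ∁? (_≟ suc j)) ∘ suc)
      (λ (p , i≢j) → p , i≢j ∘ suc-injective) (λ (p , i≢j) → p , i≢j ∘ cong suc)

  count-remove : ∀ (P? : Decidable P) {j} → P j → count P? ≡ suc (count (P? ∩? ∁? (_≟ j)))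
  count-remove {suc N} P? {zero} p with P? zero
  ... | no ¬p = ⊥-elim (¬p p)
  ... | yes _ = cong suc (count-cong (P? ∘ suc) ((P? ∩? ∁? (_≟ zero)) ∘ suc) (λ p → p , λ ()) proj₁)
  count-remove {suc N} P? {suc j} p with P? zero
  ... | yes _ = cong suc (trans (count-remove (P? ∘ suc) p) (cong suc (count-remove-shift P?)))
  ... | no _ = trans (count-remove (P? ∘ suc) p) (cong suc (count-remove-shift P?))

  count-injection : ∀ {P : Pred (Fin N) 0ℓ} {R : Pred (Fin M) 0ℓ} (P? : Decidable P) (R? : Decidable R)
    (f : Fin N → Fin M) → (∀ {i} → P i → R (f i)) → (∀ {i j} → P i → P j → f i ≡ f j → i ≡ j) →
    count P? ≤ count R?
  count-injection {zero} _ _ _ _ _ = z≤n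
  count-injection {suc N} P? R? f f-into f-inj with P? zero
  ... | no _ = count-injection (P? ∘ suc) R? (f ∘ suc) f-into (λ p q e → suc-injective (f-inj p q e))
  ... | yes p₀ = subst (suc (count (P? ∘ suc)) ≤_) (sym (count-remove R? (f-into p₀)))
    (s≤s (count-injection (P? ∘ suc) (R? ∩? ∁? (_≟ f zero)) (f ∘ suc)
      (λ p → f-into p , λ e → 0≢suc (f-inj p₀ p (sym e)))
      (λ p q e → suc-injective (f-inj p q e))))
    where
    0≢suc : ∀ {i : Fin N} → zero ≢ suc i
    0≢suc ()


module Subquasigroups where

  open Counting
  open import Data.Nat using (suc; _+_; _≤_; s≤s)
  import Data.Nat.Properties as ℕ
  open import Data.Fin using (_<_; _<?_)
  open import Data.Fin.Properties using (_≟_; all?; ≤∧≢⇒<; <-asym)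
  open import Level using (0ℓ)
  open import Relation.Nullary.Decidable using (_×-dec_; _→-dec_; ¬?)
  open import Relation.Unary using (Pred; Decidable; U)
  open import Relation.Unary.Properties using (U?; _∩?_; ∁?)

  record SteinerSubquasigroup (N : ℕ) : Set₁ where
    infixl 7 _·_
    field
      S : Pred (Fin N) 0ℓ
      S? : Decidable S
      _·_ : Fin N → Fin N → Fin N
      ·-closed : ∀ {a b} → S a → S b → S (a · b)
      idem : ∀ {a} → S a → a · a ≡ a
      comm : ∀ {a b} → S a → S b → a · b ≡ b · a
      inv : ∀ {a b} → S a → S b → a · (a · b) ≡ b

    VeblenPoint : Pred (Fin N) 0ℓ
    VeblenPoint x = S x × ∀ a c → S a → S c → a ≢ x → c ≢ x → a ≢ c → c ≢ x · a →
      (a · c) · (x · a) ≡ x · c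

    VeblenPoint? : Decidable VeblenPoint
    VeblenPoint? x = S? x ×-dec all? λ a → all? λ c →
      S? a →-dec S? c →-dec ¬? (a ≟ x) →-dec ¬? (c ≟ x) →-dec ¬? (a ≟ c) →-dec ¬? (c ≟ x · a) →-dec
      ((a · c) · (x · a) ≟ x · c)

    order : ℕ
    order = count S?

    veblenCount : ℕ
    veblenCount = count VeblenPoint?

    invʳ : ∀ {a b} → S a → S b → (a · b) · b ≡ a
    invʳ {a} {b} a∈ b∈ = trans (comm (·-closed a∈ b∈) b∈) (trans (cong (b ·_) (comm a∈ b∈)) (inv b∈ a∈))

    cancelˡ : ∀ {a b c} → S a → S b → S c → a · b ≡ a · c → b ≡ c
    cancelˡ {a} {b} {c} a∈ b∈ c∈ e = trans (sym (inv a∈ b∈)) (trans (cong (a ·_) e) (inv a∈ c∈))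

    ·-≢ˡ : ∀ {a b} → S a → S b → a ≢ b → a · b ≢ a
    ·-≢ˡ {a} a∈ b∈ a≢b e = a≢b (sym (cancelˡ a∈ b∈ a∈ (trans e (sym (idem a∈)))))

    ·-≢ʳ : ∀ {a b} → S a → S b → a ≢ b → a · b ≢ b
    ·-≢ʳ {a} {b} a∈ b∈ a≢b e = ·-≢ˡ b∈ a∈ (a≢b ∘ sym) (trans (comm b∈ a∈) e)

  fromQuasigroup : ∀ {N} → SteinerQuasigroup (Fin N) → SteinerSubquasigroup N
  fromQuasigroup Q = record
    { S = U ; S? = U? ; _·_ = _·_ ; ·-closed = _
    ; idem = λ {a} _ → idem a ; comm = λ {a} {b} _ _ → comm a b ; inv = λ {a} {b} _ _ → inv a b }
    where open SteinerQuasigroup Q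

  fromQuasigroup-veblen : ∀ {N} (Q : SteinerQuasigroup (Fin N)) {x} → IsVeblenPoint Q x →
    SteinerSubquasigroup.VeblenPoint (fromQuasigroup Q) x
  fromQuasigroup-veblen Q veb = _ , λ a c _ _ → veb a c

  -- σ = x ·_ is a fixed-point-free involution of S ∖ {x}; Rep picks the smaller point of each orbit.
  module Pairing {N : ℕ} (R : SteinerSubquasigroup N) {x : Fin N} (x∈S : SteinerSubquasigroup.S R x) where

    open SteinerSubquasigroup R

    σ : Fin N → Fin N
    σ p = x · p

    σ-closed : ∀ {p} → S p → S (σ p)
    σ-closed = ·-closed x∈S

    σ-involutive : ∀ {p} → S p → σ (σ p) ≡ p
    σ-involutive = inv x∈S

    σ-injective : ∀ {p q} → S p → S q → σ p ≡ σ q → p ≡ q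
    σ-injective = cancelˡ x∈S

    σ-≢ : ∀ {p} → S p → p ≢ x → σ p ≢ p
    σ-≢ p∈ p≢x = ·-≢ʳ x∈S p∈ (p≢x ∘ sym)

    σ-≢x : ∀ {p} → S p → p ≢ x → σ p ≢ x
    σ-≢x p∈ p≢x = ·-≢ˡ x∈S p∈ (p≢x ∘ sym)

    ≮σ⇒σ<σσ : ∀ {p} → S p → p ≢ x → ¬ p < σ p → σ p < σ (σ p)
    ≮σ⇒σ<σσ {p} p∈ p≢x p≮σp =
      subst (σ p <_) (sym (σ-involutive p∈)) (≤∧≢⇒< (ℕ.≮⇒≥ p≮σp) (σ-≢ p∈ p≢x))

    <σ⇒σ≮σσ : ∀ {p} → S p → p < σ p → ¬ σ p < σ (σ p)
    <σ⇒σ≮σσ {p} p∈ p<σp σp<σσp = <-asym p<σp (subst (σ p <_) (σ-involutive p∈) σp<σσp)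

    Off : Pred (Fin N) 0ℓ
    Off p = S p × p ≢ x

    Off? : Decidable Off
    Off? p = S? p ×-dec ¬? (p ≟ x)

    Rep : Pred (Fin N) 0ℓ
    Rep p = S p × p ≢ x × p < σ p

    Rep? : Decidable Rep
    Rep? p = S? p ×-dec ¬? (p ≟ x) ×-dec (p <? σ p)

    count-σ-closed : ∀ {D} (D? : Decidable D) → (∀ {p} → D p → Off p) → (∀ {p} → D p → D (σ p)) →
      count D? ≡ count (D? ∩? (λ p → p <? σ p)) + count (D? ∩? (λ p → p <? σ p))
    count-σ-closed {D} D? D⊆Off D-closed =
      trans (count-split D? (λ p → p <? σ p))
        (cong (count (D? ∩? (λ p → p <? σ p)) +_) (ℕ.≤-antisym
          (count-injection (D? ∩? ∁? (λ p → p <? σ p)) (D? ∩? (λ p → p <? σ p)) σ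
            (λ (d , p≮σp) → D-closed d , ≮σ⇒σ<σσ (∈S d) (≢x d) p≮σp) σ-injective′)
          (count-injection (D? ∩? (λ p → p <? σ p)) (D? ∩? ∁? (λ p → p <? σ p)) σ
            (λ (d , p<σp) → D-closed d , <σ⇒σ≮σσ (∈S d) p<σp)
            σ-injective′)))
      where
      ∈S : ∀ {p} → D p → S p
      ∈S = proj₁ ∘ D⊆Off
      ≢x : ∀ {p} → D p → p ≢ x
      ≢x = proj₂ ∘ D⊆Off
      σ-injective′ : ∀ {P : Pred (Fin N) 0ℓ} {p q} → D p × P p → D q × P q → σ p ≡ σ q → p ≡ q
      σ-injective′ (dp , _) (dq , _) = σ-injective (∈S dp) (∈S dq)

    order≡1+2·count-Rep : order ≡ suc (count Rep? + count Rep?)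
    order≡1+2·count-Rep = trans (count-remove S? x∈S) (cong suc (trans
      (count-σ-closed Off? (λ off → off) (λ (p∈ , p≢x) → σ-closed p∈ , σ-≢x p∈ p≢x))
      (cong₂ _+_ Rep≡ Rep≡)))
      where
      Rep≡ : count (Off? ∩? (λ p → p <? σ p)) ≡ count Rep?
      Rep≡ = count-cong (Off? ∩? (λ p → p <? σ p)) Rep?
        (λ ((p∈ , p≢x) , lt) → p∈ , p≢x , lt) (λ (p∈ , p≢x , lt) → (p∈ , p≢x) , lt)

  -- The quotient by a Veblen point x: its points are the lines {p , σ p} through x.
  module Quotient {N : ℕ} (R : SteinerSubquasigroup N) {x : Fin N}
                  (x-veblen : SteinerSubquasigroup.VeblenPoint R x) where

    open SteinerSubquasigroup R
    x∈S = proj₁ x-veblen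
    open Pairing R x∈S

    ·≡x⇒≡σ : ∀ {a c} → S a → S c → a · c ≡ x → c ≡ σ a
    ·≡x⇒≡σ a∈ c∈ e = trans (sym (inv a∈ c∈)) (trans (cong (_ ·_) e) (comm a∈ x∈S))

    -- Apply the Veblen property at x to the pairs (σ (a · c), a) and (a, c).
    ·-σ : ∀ {a c} → S a → S c → a ≢ x → c ≢ x → a ≢ c → c ≢ σ a → a · σ c ≡ σ (a · c)
    ·-σ {a} {c} a∈ c∈ a≢x c≢x a≢c c≢σa = begin
      a · σ c       ≡⟨ cong (a ·_) (sym w≡σc) ⟩
      a · (y′ · a)  ≡⟨ cong (a ·_) (comm y′∈ a∈) ⟩
      a · (a · y′)  ≡⟨ inv a∈ y′∈ ⟩
      y′            ∎
      where
      open ≡-Reasoning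
      y = a · c
      y∈ = ·-closed a∈ c∈
      y′ = σ y
      y′∈ = σ-closed y∈
      w = y′ · a
      w∈ = ·-closed y′∈ a∈
      y′≢a : y′ ≢ a
      y′≢a e = c≢x (cancelˡ a∈ c∈ x∈S (trans (sym (σ-involutive y∈)) (trans (cong σ e) (comm x∈S a∈))))
      a≢σy′ : a ≢ σ y′
      a≢σy′ e = ·-≢ˡ a∈ c∈ a≢c (sym (trans e (σ-involutive y∈)))
      w·y≡σa : w · y ≡ σ a
      w·y≡σa = trans (cong (w ·_) (sym (σ-involutive y∈)))
        (proj₂ x-veblen y′ a y′∈ a∈ (σ-≢x y∈ (c≢σa ∘ ·≡x⇒≡σ a∈ c∈)) a≢x y′≢a a≢σy′)
      w≡σc : w ≡ σ c
      w≡σc = begin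
        w               ≡⟨ sym (invʳ w∈ y∈) ⟩
        (w · y) · y     ≡⟨ cong (_· y) w·y≡σa ⟩
        σ a · y         ≡⟨ comm (σ-closed a∈) y∈ ⟩
        y · σ a         ≡⟨ proj₂ x-veblen a c a∈ c∈ a≢x c≢x a≢c c≢σa ⟩
        σ c             ∎

    rep : Fin N → Fin N
    rep p with p <? σ p
    ... | yes _ = p
    ... | no _ = σ p

    rep-cases : ∀ p → rep p ≡ p ⊎ rep p ≡ σ p
    rep-cases p with p <? σ p
    ... | yes _ = inj₁ refl
    ... | no _ = inj₂ refl

    rep-<σ : ∀ {p} → p < σ p → rep p ≡ p
    rep-<σ {p} p<σp with p <? σ p
    ... | yes _ = refl
    ... | no p≮σp = ⊥-elim (p≮σp p<σp)

    rep-Rep : ∀ {p} → Rep p → rep p ≡ p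
    rep-Rep (_ , _ , p<σp) = rep-<σ p<σp

    rep∈Rep : ∀ {p} → S p → p ≢ x → Rep (rep p)
    rep∈Rep {p} p∈ p≢x with p <? σ p
    ... | yes p<σp = p∈ , p≢x , p<σp
    ... | no p≮σp = σ-closed p∈ , σ-≢x p∈ p≢x , ≮σ⇒σ<σσ p∈ p≢x p≮σp

    rep-σ : ∀ {p} → S p → p ≢ x → rep (σ p) ≡ rep p
    rep-σ {p} p∈ p≢x with p <? σ p | σ p <? σ (σ p)
    ... | yes p<σp | yes σp<σσp = ⊥-elim (<σ⇒σ≮σσ p∈ p<σp σp<σσp)
    ... | yes _ | no _ = σ-involutive p∈
    ... | no _ | yes _ = refl
    ... | no p≮σp | no σp≮σσp = ⊥-elim (σp≮σσp (≮σ⇒σ<σσ p∈ p≢x p≮σp))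

    ·-≢x : ∀ {a b} → Rep a → Rep b → a · b ≢ x
    ·-≢x {a} {b} (a∈ , a≢x , a<σa) (b∈ , _ , b<σb) e with a ≟ b
    ... | yes refl = a≢x (trans (sym (idem a∈)) e)
    ... | no _ = <σ⇒σ≮σσ a∈ a<σa (subst₂ _<_ b≡σa (cong σ b≡σa) b<σb)
      where
      b≡σa : b ≡ σ a
      b≡σa = ·≡x⇒≡σ a∈ b∈ e

    infixl 7 _·′_
    _·′_ : Fin N → Fin N → Fin N
    a ·′ b = rep (a · b)

    quotient : SteinerSubquasigroup N
    quotient = record
      { S = Rep ; S? = Rep? ; _·_ = _·′_
      ; ·-closed = λ a′ b′ → rep∈Rep (·-closed (proj₁ a′) (proj₁ b′)) (·-≢x a′ b′)
      ; idem = idem′ ; comm = λ a′ b′ → cong rep (comm (proj₁ a′) (proj₁ b′)) ; inv = inv′ }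
      where
      idem′ : ∀ {a} → Rep a → a ·′ a ≡ a
      idem′ a′@(a∈ , _) = trans (cong rep (idem a∈)) (rep-Rep a′)

      inv′ : ∀ {a b} → Rep a → Rep b → a ·′ (a ·′ b) ≡ b
      inv′ {a} {b} a′@(a∈ , a≢x , _) b′@(b∈ , b≢x , _) with a ≟ b | rep-cases (a · b)
      ... | yes refl | _ = trans (cong (a ·′_) (idem′ a′)) (idem′ a′)
      ... | no _ | inj₁ e = trans (cong (a ·′_) e) (trans (cong rep (inv a∈ b∈)) (rep-Rep b′))
      ... | no a≢b | inj₂ e = begin
        a ·′ (a ·′ b)          ≡⟨ cong (a ·′_) e ⟩
        rep (a · σ (a · b))    ≡⟨ cong rep (·-σ a∈ (·-closed a∈ b∈) a≢x (·-≢x a′ b′) a≢ab ab≢σa) ⟩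
        rep (σ (a · (a · b)))  ≡⟨ cong (rep ∘ σ) (inv a∈ b∈) ⟩
        rep (σ b)              ≡⟨ rep-σ b∈ b≢x ⟩
        rep b                  ≡⟨ rep-Rep b′ ⟩
        b                      ∎
        where
        open ≡-Reasoning
        a≢ab : a ≢ a · b
        a≢ab = ·-≢ˡ a∈ b∈ a≢b ∘ sym
        ab≢σa : a · b ≢ σ a
        ab≢σa e′ = b≢x (cancelˡ a∈ b∈ x∈S (trans e′ (comm x∈S a∈)))

    private
      ≢σ-sym : ∀ {p q} → S q → q ≢ σ p → p ≢ σ q
      ≢σ-sym q∈ q≢σp e = q≢σp (trans (sym (σ-involutive q∈)) (cong σ (sym e)))

      ·≢x : ∀ {p q} → S p → S q → q ≢ σ p → p · q ≢ x
      ·≢x p∈ q∈ q≢σp = q≢σp ∘ ·≡x⇒≡σ p∈ q∈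

    rep-·σ : ∀ {p q} → S p → S q → p ≢ x → q ≢ x → q ≢ p → q ≢ σ p → rep (p · σ q) ≡ rep (p · q)
    rep-·σ p∈ q∈ p≢x q≢x q≢p q≢σp =
      trans (cong rep (·-σ p∈ q∈ p≢x q≢x (q≢p ∘ sym) q≢σp)) (rep-σ (·-closed p∈ q∈) (·≢x p∈ q∈ q≢σp))

    rep-σ· : ∀ {p q} → S p → S q → p ≢ x → q ≢ x → q ≢ p → q ≢ σ p → rep (σ p · q) ≡ rep (p · q)
    rep-σ· {p} {q} p∈ q∈ p≢x q≢x q≢p q≢σp = begin
      rep (σ p · q)   ≡⟨ cong rep (comm (σ-closed p∈) q∈) ⟩
      rep (q · σ p)   ≡⟨ rep-·σ q∈ p∈ q≢x p≢x (q≢p ∘ sym) (≢σ-sym q∈ q≢σp) ⟩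
      rep (q · p)     ≡⟨ cong rep (comm q∈ p∈) ⟩
      rep (p · q)     ∎
      where open ≡-Reasoning

    rep-·-rep : ∀ {p q} → S p → S q → p ≢ x → q ≢ x → q ≢ p → q ≢ σ p →
      rep (rep p · rep q) ≡ rep (p · q)
    rep-·-rep {p} {q} p∈ q∈ p≢x q≢x q≢p q≢σp with rep-cases p | rep-cases q
    ... | inj₁ e₁ | inj₁ e₂ = cong rep (cong₂ _·_ e₁ e₂)
    ... | inj₂ e₁ | inj₁ e₂ = trans (cong rep (cong₂ _·_ e₁ e₂)) (rep-σ· p∈ q∈ p≢x q≢x q≢p q≢σp)
    ... | inj₁ e₁ | inj₂ e₂ = trans (cong rep (cong₂ _·_ e₁ e₂)) (rep-·σ p∈ q∈ p≢x q≢x q≢p q≢σp)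
    ... | inj₂ e₁ | inj₂ e₂ = trans (cong rep (cong₂ _·_ e₁ e₂))
      (trans (rep-σ· p∈ (σ-closed q∈) p≢x (σ-≢x q∈ q≢x) (≢σ-sym q∈ q≢σp ∘ sym) (q≢p ∘ σ-injective q∈ p∈))
             (rep-·σ p∈ q∈ p≢x q≢x q≢p q≢σp))

    module R′ = SteinerSubquasigroup quotient

    private
      ≢rep⇒∉orbit : ∀ {u p} → S u → u ≢ x → Rep p → p ≢ rep u → p ≢ u × p ≢ σ u
      ≢rep⇒∉orbit u∈ u≢x p′ p≢ru =
        (λ e → p≢ru (trans (sym (rep-Rep p′)) (cong rep e))) ,
        (λ e → p≢ru (trans (sym (rep-Rep p′)) (trans (cong rep e) (rep-σ u∈ u≢x))))

      rep-·′ : ∀ {u p} → S u → u ≢ x → Rep p → p ≢ rep u → rep u ·′ p ≡ rep (u · p)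
      rep-·′ {u} u∈ u≢x p′@(p∈ , p≢x , _) p≢ru =
        let p≢u , p≢σu = ≢rep⇒∉orbit u∈ u≢x p′ p≢ru
        in trans (cong (λ z → rep (rep u · z)) (sym (rep-Rep p′))) (rep-·-rep u∈ p∈ u≢x p≢x p≢u p≢σu)

    veblen-rep : ∀ {u} → VeblenPoint u → u ≢ x → R′.VeblenPoint (rep u)
    veblen-rep {u} (u∈ , u-veblen) u≢x = rep∈Rep u∈ u≢x , veblen′
      where
      veblen′ : ∀ a c → Rep a → Rep c → a ≢ rep u → c ≢ rep u → a ≢ c → c ≢ rep u ·′ a →
        (a ·′ c) ·′ (rep u ·′ a) ≡ rep u ·′ c
      veblen′ a c a′@(a∈ , a≢x , _) c′@(c∈ , c≢x , _) a≢ru c≢ru a≢c c≢ru·a = begin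
        (a ·′ c) ·′ (rep u ·′ a)
          ≡⟨ cong (λ z → rep (rep (a · c) · z)) (rep-·′ u∈ u≢x a′ a≢ru) ⟩
        rep (rep (a · c) · rep (u · a))
          ≡⟨ rep-·-rep (·-closed a∈ c∈) (·-closed u∈ a∈) (·-≢x a′ c′) ua≢x ua≢ac ua≢σac ⟩
        rep ((a · c) · (u · a))            ≡⟨ cong rep (u-veblen a c a∈ c∈ a≢u c≢u a≢c c≢ua) ⟩
        rep (u · c)                        ≡⟨ sym (rep-·′ u∈ u≢x c′ c≢ru) ⟩
        rep u ·′ c                         ∎
        where
        open ≡-Reasoning
        a≢u = proj₁ (≢rep⇒∉orbit u∈ u≢x a′ a≢ru)
        a≢σu = proj₂ (≢rep⇒∉orbit u∈ u≢x a′ a≢ru)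
        c≢u = proj₁ (≢rep⇒∉orbit u∈ u≢x c′ c≢ru)
        c≢σu = proj₂ (≢rep⇒∉orbit u∈ u≢x c′ c≢ru)
        c≢σa : c ≢ σ a
        c≢σa e = a≢c (sym (trans (sym (rep-Rep c′)) (trans (cong rep e) (trans (rep-σ a∈ a≢x) (rep-Rep a′)))))
        c≢ua : c ≢ u · a
        c≢ua e = c≢ru·a (trans (sym (rep-Rep c′)) (trans (cong rep e) (sym (rep-·′ u∈ u≢x a′ a≢ru))))
        ua≢x : u · a ≢ x
        ua≢x = ·≢x u∈ a∈ a≢σu
        ua≢ac : u · a ≢ a · c
        ua≢ac e = c≢u (sym (cancelˡ a∈ u∈ c∈ (trans (comm a∈ u∈) e)))
        ua≢σac : u · a ≢ σ (a · c)
        ua≢σac e = c≢σu (trans (sym (σ-involutive c∈)) (cong σ (sym u≡σc)))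
          where
          u≡σc : u ≡ σ c
          u≡σc = cancelˡ a∈ u∈ (σ-closed c∈)
            (trans (comm a∈ u∈) (trans e (sym (·-σ a∈ c∈ a≢x c≢x a≢c c≢σa))))

    OverVeblen : Pred (Fin N) 0ℓ
    OverVeblen p = Off p × R′.VeblenPoint (rep p)

    OverVeblen? : Decidable OverVeblen
    OverVeblen? p = Off? p ×-dec R′.VeblenPoint? (rep p)

    veblenCount≤ : veblenCount ≤ suc (R′.veblenCount + R′.veblenCount)
    veblenCount≤ = subst (_≤ suc (R′.veblenCount + R′.veblenCount)) (sym (count-remove VeblenPoint? x-veblen))
      (s≤s (ℕ.≤-trans
        (count-mono (VeblenPoint? ∩? ∁? (_≟ x)) OverVeblen?
          (λ ((u∈ , u-veblen) , u≢x) → (u∈ , u≢x) , veblen-rep (u∈ , u-veblen) u≢x))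
        (subst (_≤ R′.veblenCount + R′.veblenCount)
          (sym (count-σ-closed OverVeblen? proj₁
            (λ ((p∈ , p≢x) , v) → (σ-closed p∈ , σ-≢x p∈ p≢x) , subst R′.VeblenPoint (sym (rep-σ p∈ p≢x)) v)))
          (ℕ.+-mono-≤ rep-bound rep-bound))))
      where
      rep-bound : count (OverVeblen? ∩? (λ p → p <? σ p)) ≤ R′.veblenCount
      rep-bound = count-mono (OverVeblen? ∩? (λ p → p <? σ p)) R′.VeblenPoint?
        (λ ((_ , v) , p<σp) → subst R′.VeblenPoint (rep-<σ p<σp) v)


module Arithmetic where

  open import Data.Nat using (suc; _+_; _*_; _^_; _<_; _%_; s≤s)
  open import Data.Nat.Properties using (+-comm; *-assoc; 1+n≢0)
  open import Data.Nat.DivMod using (%-distribˡ-+; m%n<n; m∣n⇒o%n%m≡o%m; m%n*o≡m*o%[n*o])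
  open import Data.Nat.Divisibility using (_∣_; divides; ∣m⇒∣m*n; n∣m⇒m%n≡0; m%n≡0⇒n∣m)

  suc-%6 : ∀ w → suc w % 6 ≡ suc (w % 6) % 6
  suc-%6 w = %-distribˡ-+ 1 w 6

  admissible⇒suc-%6 : ∀ {w} → Admissible w → suc w % 6 ≡ 2 ⊎ suc w % 6 ≡ 4
  admissible⇒suc-%6 {w} (inj₁ w%6≡1) = inj₁ (trans (suc-%6 w) (cong (λ r → suc r % 6) w%6≡1))
  admissible⇒suc-%6 {w} (inj₂ w%6≡3) = inj₂ (trans (suc-%6 w) (cong (λ r → suc r % 6) w%6≡3))

  suc-%6⇒admissible : ∀ w → suc w % 6 ≡ 2 ⊎ suc w % 6 ≡ 4 → Admissible w
  suc-%6⇒admissible w h = residue (w % 6) (m%n<n w 6) (subst (λ n → n ≡ 2 ⊎ n ≡ 4) (suc-%6 w) h)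
    where
    residue : ∀ r → r < 6 → suc r % 6 ≡ 2 ⊎ suc r % 6 ≡ 4 → r ≡ 1 ⊎ r ≡ 3
    residue 1 _ _ = inj₁ refl
    residue 3 _ _ = inj₂ refl
    residue 0 _ (inj₁ ())
    residue 0 _ (inj₂ ())
    residue 2 _ (inj₁ ())
    residue 2 _ (inj₂ ())
    residue 4 _ (inj₁ ())
    residue 4 _ (inj₂ ())
    residue 5 _ (inj₁ ())
    residue 5 _ (inj₂ ())
    residue (suc (suc (suc (suc (suc (suc _)))))) (s≤s (s≤s (s≤s (s≤s (s≤s (s≤s ())))))) _

  admissible⇒3∤suc : ∀ {v} → Admissible v → ¬ 3 ∣ suc v
  admissible⇒3∤suc {v} adm 3∣
    with suc v % 6 | admissible⇒suc-%6 {v} adm | m∣n⇒o%n%m≡o%m 3 6 (suc v) (divides 2 refl)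
  ... | _ | inj₁ refl | mod3 = 1+n≢0 (trans mod3 (n∣m⇒m%n≡0 (suc v) 3 3∣))
  ... | _ | inj₂ refl | mod3 = 1+n≢0 (trans mod3 (n∣m⇒m%n≡0 (suc v) 3 3∣))

  -- k = 2 j with 3 ∤ j, because 3 ∤ v + 1.
  shape-of-order : ∀ {v t} → Admissible v → 2 ^ suc t ∣ suc v →
    ∃ λ k → v + 1 ≡ k * 2 ^ t × (k % 6 ≡ 2 ⊎ k % 6 ≡ 4)
  shape-of-order {v} {t} adm (divides j sucv≡) =
    j * 2 , trans (+-comm v 1) (trans sucv≡ (sym (*-assoc j 2 (2 ^ t)))) ,
    subst (λ n → n ≡ 2 ⊎ n ≡ 4) (m%n*o≡m*o%[n*o] j 3 2) (residue (j % 3) (m%n<n j 3) 3∤j)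
    where
    3∤j : j % 3 ≢ 0
    3∤j e = admissible⇒3∤suc adm (subst (3 ∣_) (sym sucv≡) (∣m⇒∣m*n (2 ^ suc t) (m%n≡0⇒n∣m j 3 e)))
    residue : ∀ r → r < 3 → r ≢ 0 → r * 2 ≡ 2 ⊎ r * 2 ≡ 4
    residue 0 _ r≢0 = ⊥-elim (r≢0 refl)
    residue 1 _ _ = inj₁ refl
    residue 2 _ _ = inj₂ refl
    residue (suc (suc (suc _))) (s≤s (s≤s (s≤s ()))) _


module Necessity where

  open Counting
  open Subquasigroups
  open Arithmetic
  open import Data.Nat using (suc; zero; _+_; _*_; _^_; _∸_; _≤_; _<_; _%_; s≤s)
  import Data.Nat.Properties as ℕ
  open import Data.Nat.Divisibility using (_∣_; *-monoʳ-∣; 1∣_)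
  open import Relation.Nullary using (contradiction)
  open import Relation.Unary.Properties using (U?)

  half-≤ : ∀ {a b} → a + a ≤ suc (b + b) → a ≤ b
  half-≤ {a} {b} a+a≤ with a ℕ.≤? b
  ... | yes a≤b = a≤b
  ... | no a≰b = contradiction a+a≤ (ℕ.<⇒≱ (subst (_≤ a + a) (cong suc (ℕ.+-suc b b)) (ℕ.+-mono-≤ b<a b<a)))
    where
    b<a = ℕ.≰⇒> a≰b

  ∣-double-suc : ∀ {d} m → d ∣ suc m → 2 * d ∣ suc (suc (m + m))
  ∣-double-suc {d} m d∣ = subst (2 * d ∣_) 2*suc≡ (*-monoʳ-∣ 2 d∣)
    where
    2*suc≡ : 2 * suc m ≡ suc (suc (m + m))
    2*suc≡ = cong suc (trans (cong (m +_) (ℕ.+-identityʳ (suc m))) (ℕ.+-suc m m))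

  2^suc≡ : ∀ t → 2 ^ suc t ≡ 2 ^ t + 2 ^ t
  2^suc≡ t = cong (2 ^ t +_) (ℕ.+-identityʳ (2 ^ t))

  -- Induction on t, passing to the quotient by a Veblen point: it halves the order
  -- (up to one) and at most halves the number of Veblen points (up to one).
  order-divisible : ∀ t {N} (R : SteinerSubquasigroup N) → let open SteinerSubquasigroup R in
    2 ^ t ≤ order → 2 ^ t ≤ suc veblenCount → 2 ^ suc t ∣ suc order
  order-divisible zero R 1≤order _ =
    let open SteinerSubquasigroup R
        _ , x∈S = count>0⇒∃ S? 1≤order
        open Pairing R x∈S
    in subst (2 ^ 1 ∣_) (sym (cong suc order≡1+2·count-Rep)) (∣-double-suc (count Rep?) (1∣ _))
  order-divisible (suc t) R 2^[1+t]≤order 2^[1+t]≤veblen =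
    subst (2 ^ suc (suc t) ∣_) (sym (cong suc order≡1+2·count-Rep))
      (∣-double-suc R′.order (order-divisible t quotient 2^t≤order′ 2^t≤veblen′))
    where
    open SteinerSubquasigroup R
    1≤veblenCount : 1 ≤ veblenCount
    1≤veblenCount = ℕ.≤-pred (ℕ.≤-trans (ℕ.*-monoʳ-≤ 2 (ℕ.m^n>0 2 t)) 2^[1+t]≤veblen)
    x-veblen = proj₂ (count>0⇒∃ VeblenPoint? 1≤veblenCount)
    open Quotient R x-veblen
    open Pairing R x∈S
    2^t≤order′ : 2 ^ t ≤ R′.order
    2^t≤order′ = half-≤ {2 ^ t} {R′.order} (subst₂ _≤_ (2^suc≡ t) order≡1+2·count-Rep 2^[1+t]≤order)
    2^t≤veblen′ : 2 ^ t ≤ suc R′.veblenCount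
    2^t≤veblen′ = half-≤ {2 ^ t} {suc R′.veblenCount} (begin
      2 ^ t + 2 ^ t                                 ≡⟨ sym (2^suc≡ t) ⟩
      2 ^ suc t                                     ≤⟨ 2^[1+t]≤veblen ⟩
      suc veblenCount                               ≤⟨ s≤s veblenCount≤ ⟩
      suc (suc (R′.veblenCount + R′.veblenCount))   ≤⟨ s≤s (s≤s (ℕ.+-monoʳ-≤ R′.veblenCount (ℕ.n≤1+n _))) ⟩
      suc (suc R′.veblenCount + suc R′.veblenCount) ∎)
      where open ℕ.≤-Reasoning

  necessity : ∀ v t → Admissible v → 2 ^ t ∸ 1 < v →
    (∃ λ (B : List (Triple v)) → IsSTS B × AtLeastVeblen B (2 ^ t ∸ 1)) →
    ∃ λ k → v + 1 ≡ k * 2 ^ t × (k % 6 ≡ 2 ⊎ k % 6 ≡ 4)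
  necessity v t adm 2^t∸1<v (B , sts , f , f-injective , f-veblen) =
    shape-of-order {t = t} adm (subst (λ n → 2 ^ suc t ∣ suc n) count-U (order-divisible t R 2^t≤v 2^t≤veblen))
    where
    open FromSTS B sts
    R = fromQuasigroup quasigroup
    open SteinerSubquasigroup R using (VeblenPoint?; veblenCount)
    2^t≤suc[2^t∸1] : 2 ^ t ≤ suc (2 ^ t ∸ 1)
    2^t≤suc[2^t∸1] = ℕ.m≤n+m∸n (2 ^ t) 1
    2^t≤v : 2 ^ t ≤ count {v} U?
    2^t≤v = subst (2 ^ t ≤_) (sym count-U) (ℕ.≤-trans 2^t≤suc[2^t∸1] 2^t∸1<v)
    2^t≤veblen : 2 ^ t ≤ suc veblenCount
    2^t≤veblen = ℕ.≤-trans 2^t≤suc[2^t∸1] (s≤s (subst (_≤ veblenCount) count-U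
      (count-injection U? VeblenPoint? f (λ {i} _ → fromQuasigroup-veblen quasigroup (veblen (f-veblen i)))
        (λ _ _ → f-injective))))


module Isomorphisms where

  open import Data.Nat using (suc; _*_)
  open import Data.Fin using (zero; suc)
  open import Data.Fin.Properties using (*↔×; 2↔Bool)
  import Data.Maybe as Maybe
  open import Data.Product.Function.NonDependent.Propositional using (_×-↔_)
  open import Function.Bundles using (Injection; mk↔ₛ′)
  open import Function.Definitions using (Injective)
  open import Function.Properties.Inverse using (↔-refl; ↔-sym; ↔-trans; Inverse⇒Injection)

  module _ {A B : Set} (I : A ↔ B) where

    open Inverse I

    to-injective : Injective _≡_ _≡_ to
    to-injective = Injection.injective (Inverse⇒Injection I)

    from-injective : Injective _≡_ _≡_ from
    from-injective = Injection.injective (Inverse⇒Injection (↔-sym I))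

    Maybe-↔ : Maybe A ↔ Maybe B
    Maybe-↔ = mk↔ₛ′ (Maybe.map to) (Maybe.map from) to∘from from∘to
      where
      to∘from : ∀ y → Maybe.map to (Maybe.map from y) ≡ y
      to∘from nothing = refl
      to∘from (just b) = cong just (strictlyInverseˡ b)
      from∘to : ∀ x → Maybe.map from (Maybe.map to x) ≡ x
      from∘to nothing = refl
      from∘to (just a) = cong just (strictlyInverseʳ a)

  suc↔Maybe : ∀ {n} → Fin (suc n) ↔ Maybe (Fin n)
  suc↔Maybe = mk↔ₛ′ to from to∘from from∘to
    where
    to : ∀ {n} → Fin (suc n) → Maybe (Fin n)
    to zero = nothing
    to (suc i) = just i
    from : ∀ {n} → Maybe (Fin n) → Fin (suc n)
    from nothing = zero
    from (just i) = suc i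
    to∘from : ∀ {n} (y : Maybe (Fin n)) → to (from y) ≡ y
    to∘from nothing = refl
    to∘from (just _) = refl
    from∘to : ∀ {n} (x : Fin (suc n)) → from (to x) ≡ x
    from∘to zero = refl
    from∘to (suc _) = refl

  doubling-↔ : ∀ {n} → Fin (suc (2 * n)) ↔ Maybe (Bool × Fin n)
  doubling-↔ = ↔-trans suc↔Maybe (Maybe-↔ (↔-trans *↔× (2↔Bool ×-↔ ↔-refl)))


module Transport {A B : Set} (I : A ↔ B) (Q : SteinerQuasigroup B) where

  open Inverse I
  open SteinerQuasigroup Q
  open Isomorphisms using (to-injective)

  quasigroup : SteinerQuasigroup A
  quasigroup = record
    { _·_ = λ a a′ → from (to a · to a′)
    ; idem = λ a → trans (cong from (idem (to a))) (strictlyInverseʳ a)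
    ; comm = λ a a′ → cong from (comm (to a) (to a′))
    ; inv = λ a a′ → trans (cong (λ b → from (to a · b)) (strictlyInverseˡ _))
                           (trans (cong from (inv (to a) (to a′))) (strictlyInverseʳ a′))
    }

  veblen : ∀ {x} → IsVeblenPoint Q (to x) → IsVeblenPoint quasigroup x
  veblen {x} veb a c a≢x c≢x a≢c c≢xa = cong from (begin
    to (from (to a · to c)) · to (from (to x · to a))  ≡⟨ cong₂ _·_ (strictlyInverseˡ _) (strictlyInverseˡ _) ⟩
    (to a · to c) · (to x · to a)                      ≡⟨ veb (to a) (to c) (a≢x ∘ to-injective I) (c≢x ∘ to-injective I)
                                                               (a≢c ∘ to-injective I) to-c≢ ⟩
    to x · to c                                        ∎)
    where
    open ≡-Reasoning
    to-c≢ : to c ≢ to x · to a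
    to-c≢ e = c≢xa (trans (sym (strictlyInverseʳ c)) (cong from e))


module Bits where

  open import Data.Bool using (not; _xor_)
  open import Data.Bool.Properties using (not-involutive; xor-inverseʳ; ¬-not)

  private
    variable
      a c : Bool

  ≢⇒not≡ : a ≢ c → not a ≡ c
  ≢⇒not≡ a≢c = sym (¬-not (a≢c ∘ sym))

  ≢⇒xor≡true : a ≢ c → a xor c ≡ true
  ≢⇒xor≡true {a} a≢c = trans (cong (a xor_) (sym (≢⇒not≡ a≢c))) (xor-inverseʳ a)

  ≢∧≢not⇒⊥ : a ≢ c → c ≢ not a → ⊥
  ≢∧≢not⇒⊥ a≢c c≢¬a = c≢¬a (sym (≢⇒not≡ a≢c))

  xor-cancelˡ : ∀ a c → a xor (a xor c) ≡ c
  xor-cancelˡ false c = refl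
  xor-cancelˡ true c = not-involutive c

  [a⊕c]⊕¬a≡¬c : ∀ a c → (a xor c) xor not a ≡ not c
  [a⊕c]⊕¬a≡¬c false false = refl
  [a⊕c]⊕¬a≡¬c false true = refl
  [a⊕c]⊕¬a≡¬c true false = refl
  [a⊕c]⊕¬a≡¬c true true = refl

  ¬a⊕[b⊕a]≡¬b : ∀ a b → not a xor (b xor a) ≡ not b
  ¬a⊕[b⊕a]≡¬b false false = refl
  ¬a⊕[b⊕a]≡¬b false true = refl
  ¬a⊕[b⊕a]≡¬b true false = refl
  ¬a⊕[b⊕a]≡¬b true true = refl

  [a⊕c]⊕[b⊕a]≡b⊕c : ∀ a b c → (a xor c) xor (b xor a) ≡ b xor c
  [a⊕c]⊕[b⊕a]≡b⊕c false false false = refl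
  [a⊕c]⊕[b⊕a]≡b⊕c false false true = refl
  [a⊕c]⊕[b⊕a]≡b⊕c false true false = refl
  [a⊕c]⊕[b⊕a]≡b⊕c false true true = refl
  [a⊕c]⊕[b⊕a]≡b⊕c true false false = refl
  [a⊕c]⊕[b⊕a]≡b⊕c true false true = refl
  [a⊕c]⊕[b⊕a]≡b⊕c true true false = refl
  [a⊕c]⊕[b⊕a]≡b⊕c true true true = refl


-- The doubling construction: two copies of P indexed by a bit, plus a new point ∞.
-- Its blocks are {∞, ⟨ 0 , p ⟩, ⟨ 1 , p ⟩} and {⟨ a , p ⟩, ⟨ c , q ⟩, ⟨ a xor c , p · q ⟩} for p ≢ q.
module Doubling {P : Set} (_≟_ : DecidableEquality P) (Q : SteinerQuasigroup P) where

  open SteinerQuasigroup Q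
  open Bits
  open import Data.Bool using (not; _xor_; if_then_else_)
  open import Data.Bool.Properties
    using (not-involutive; xor-comm; not-¬; not-distribˡ-xor; not-distribʳ-xor; xor-annihilates-not)

  Point : Set
  Point = Maybe (Bool × P)

  pattern ∞ = nothing
  pattern ⟨_,_⟩ b p = just (b , p)

  private
    variable
      a b c : Bool
      p q u : P

  same : Bool → Bool → P → Point
  same a c p = if a xor c then ∞ else ⟨ a , p ⟩

  infixl 7 _∙_
  _∙_ : Point → Point → Point
  ∞ ∙ ∞ = ∞
  ∞ ∙ ⟨ c , q ⟩ = ⟨ not c , q ⟩
  ⟨ a , p ⟩ ∙ ∞ = ⟨ not a , p ⟩
  ⟨ a , p ⟩ ∙ ⟨ c , q ⟩ with p ≟ q
  ... | yes _ = same a c p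
  ... | no _ = ⟨ a xor c , p · q ⟩

  ∙-same : ∀ a c p → ⟨ a , p ⟩ ∙ ⟨ c , p ⟩ ≡ same a c p
  ∙-same a c p with p ≟ p
  ... | yes _ = refl
  ... | no p≢p = ⊥-elim (p≢p refl)

  ∙-diff : ∀ a c → p ≢ q → ⟨ a , p ⟩ ∙ ⟨ c , q ⟩ ≡ ⟨ a xor c , p · q ⟩
  ∙-diff {p} {q} a c p≢q with p ≟ q
  ... | yes p≡q = ⊥-elim (p≢q p≡q)
  ... | no _ = refl

  bit-≢ : ⟨ a , p ⟩ ≢ ⟨ c , p ⟩ → a ≢ c
  bit-≢ A≢C refl = A≢C refl

  same-≡ : ∀ a p → same a a p ≡ ⟨ a , p ⟩
  same-≡ false p = refl
  same-≡ true p = refl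

  same-≢ : a ≢ c → same a c p ≡ ∞
  same-≢ {a} {c} {p} a≢c = cong (λ t → if t then ∞ else ⟨ a , p ⟩) (≢⇒xor≡true a≢c)

  doubled : SteinerQuasigroup Point
  doubled = record { _·_ = _∙_ ; idem = ∙-idem ; comm = ∙-comm ; inv = ∙-inv }
    where
    ∙-idem : ∀ x → x ∙ x ≡ x
    ∙-idem ∞ = refl
    ∙-idem ⟨ a , p ⟩ = trans (∙-same a a p) (same-≡ a p)

    ∙-comm : ∀ x y → x ∙ y ≡ y ∙ x
    ∙-comm ∞ ∞ = refl
    ∙-comm ∞ ⟨ _ , _ ⟩ = refl
    ∙-comm ⟨ _ , _ ⟩ ∞ = refl
    ∙-comm ⟨ a , p ⟩ ⟨ c , q ⟩ with p ≟ q
    ... | yes refl = trans (same-comm a c) (sym (∙-same c a p))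
      where
      same-comm : ∀ a c → same a c p ≡ same c a p
      same-comm false false = refl
      same-comm false true = refl
      same-comm true false = refl
      same-comm true true = refl
    ... | no p≢q = trans (cong₂ ⟨_,_⟩ (xor-comm a c) (comm p q)) (sym (∙-diff c a (p≢q ∘ sym)))

    ∙-inv : ∀ x y → x ∙ (x ∙ y) ≡ y
    ∙-inv ∞ ∞ = refl
    ∙-inv ∞ ⟨ c , q ⟩ = cong (⟨_, q ⟩) (not-involutive c)
    ∙-inv ⟨ a , p ⟩ ∞ = trans (∙-same a (not a) p) (same-≢ (not-¬ refl))
    ∙-inv ⟨ a , p ⟩ ⟨ c , q ⟩ with p ≟ q
    ∙-inv ⟨ false , p ⟩ ⟨ false , .p ⟩ | yes refl = ∙-same false false p
    ∙-inv ⟨ false , p ⟩ ⟨ true , .p ⟩ | yes refl = refl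
    ∙-inv ⟨ true , p ⟩ ⟨ false , .p ⟩ | yes refl = refl
    ∙-inv ⟨ true , p ⟩ ⟨ true , .p ⟩ | yes refl = ∙-same true true p
    ... | no p≢q = trans (∙-diff a (a xor c) (·-≢ˡ p≢q ∘ sym)) (cong₂ ⟨_,_⟩ (xor-cancelˡ a c) (inv p q))

  veblen-∞ : IsVeblenPoint doubled ∞
  veblen-∞ ∞ _ A≢∞ _ _ _ = ⊥-elim (A≢∞ refl)
  veblen-∞ ⟨ _ , _ ⟩ ∞ _ C≢∞ _ _ = ⊥-elim (C≢∞ refl)
  veblen-∞ ⟨ a , p ⟩ ⟨ c , q ⟩ _ _ A≢C C≢∞A with p ≟ q
  ... | yes refl = ⊥-elim (≢∧≢not⇒⊥ (bit-≢ A≢C) (bit-≢ C≢∞A))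
  ... | no p≢q = trans (∙-diff (a xor c) (not a) (·-≢ˡ p≢q))
    (cong₂ ⟨_,_⟩ ([a⊕c]⊕¬a≡¬c a c) (trans (comm (p · q) p) (inv p q)))

  -- The Veblen property at ⟨ b , u ⟩ for A = ⟨ a , p ⟩ and C = ⟨ c , q ⟩, by the position of
  -- p and q relative to u; only the generic case uses that u is a Veblen point of Q.
  private
    VeblenGoal : Bool → P → Point → Point → Set
    VeblenGoal b u A C = (A ∙ C) ∙ (⟨ b , u ⟩ ∙ A) ≡ ⟨ b , u ⟩ ∙ C

    A-over-u : ∀ a b c u q → a ≢ b → ⟨ c , q ⟩ ≢ ⟨ b , u ⟩ → ⟨ a , u ⟩ ≢ ⟨ c , q ⟩ →
      VeblenGoal b u ⟨ a , u ⟩ ⟨ c , q ⟩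
    A-over-u a b c u q a≢b C≢x A≢C with q ≟ u
    ... | yes refl = ⊥-elim (≢∧≢not⇒⊥ (bit-≢ A≢C) (λ c≡¬a → bit-≢ C≢x (trans c≡¬a (≢⇒not≡ a≢b))))
    ... | no q≢u = begin
      (⟨ a , u ⟩ ∙ ⟨ c , q ⟩) ∙ (⟨ b , u ⟩ ∙ ⟨ a , u ⟩)
        ≡⟨ cong₂ _∙_ (∙-diff a c (q≢u ∘ sym)) (trans (∙-same b a u) (same-≢ (a≢b ∘ sym))) ⟩
      ⟨ not (a xor c) , u · q ⟩
        ≡⟨ cong (λ t → ⟨ t , u · q ⟩) (trans (not-distribˡ-xor a c) (cong (_xor c) (≢⇒not≡ a≢b))) ⟩
      ⟨ b xor c , u · q ⟩
        ≡⟨ sym (∙-diff b c (q≢u ∘ sym)) ⟩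
      ⟨ b , u ⟩ ∙ ⟨ c , q ⟩ ∎
      where open ≡-Reasoning

    C-over-u : ∀ a b c u p → p ≢ u → c ≢ b → VeblenGoal b u ⟨ a , p ⟩ ⟨ c , u ⟩
    C-over-u a b c u p p≢u c≢b = begin
      (⟨ a , p ⟩ ∙ ⟨ c , u ⟩) ∙ (⟨ b , u ⟩ ∙ ⟨ a , p ⟩)
        ≡⟨ cong₂ _∙_ (∙-diff a c p≢u) (∙-diff b a (p≢u ∘ sym)) ⟩
      ⟨ a xor c , p · u ⟩ ∙ ⟨ b xor a , u · p ⟩
        ≡⟨ cong (λ r → ⟨ a xor c , r ⟩ ∙ ⟨ b xor a , u · p ⟩) (comm p u) ⟩
      ⟨ a xor c , u · p ⟩ ∙ ⟨ b xor a , u · p ⟩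
        ≡⟨ ∙-same (a xor c) (b xor a) (u · p) ⟩
      same (a xor c) (b xor a) (u · p)
        ≡⟨ cong (λ t → if t then ∞ else ⟨ a xor c , u · p ⟩)
                (trans ([a⊕c]⊕[b⊕a]≡b⊕c a b c) (≢⇒xor≡true (c≢b ∘ sym))) ⟩
      ∞
        ≡⟨ sym (trans (∙-same b c u) (same-≢ (c≢b ∘ sym))) ⟩
      ⟨ b , u ⟩ ∙ ⟨ c , u ⟩ ∎
      where open ≡-Reasoning

    C-over-A : ∀ a b c u p → p ≢ u → a ≢ c → VeblenGoal b u ⟨ a , p ⟩ ⟨ c , p ⟩
    C-over-A a b c u p p≢u a≢c = begin
      (⟨ a , p ⟩ ∙ ⟨ c , p ⟩) ∙ (⟨ b , u ⟩ ∙ ⟨ a , p ⟩)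
        ≡⟨ cong₂ _∙_ (trans (∙-same a c p) (same-≢ a≢c)) (∙-diff b a (p≢u ∘ sym)) ⟩
      ⟨ not (b xor a) , u · p ⟩
        ≡⟨ cong (λ t → ⟨ t , u · p ⟩) (trans (not-distribʳ-xor b a) (cong (b xor_) (≢⇒not≡ a≢c))) ⟩
      ⟨ b xor c , u · p ⟩
        ≡⟨ sym (∙-diff b c (p≢u ∘ sym)) ⟩
      ⟨ b , u ⟩ ∙ ⟨ c , p ⟩ ∎
      where open ≡-Reasoning

    C-on-line-uA : ∀ a b c u p → p ≢ u → VeblenGoal b u ⟨ a , p ⟩ ⟨ c , u · p ⟩
    C-on-line-uA a b c u p p≢u = begin
      (⟨ a , p ⟩ ∙ ⟨ c , u · p ⟩) ∙ (⟨ b , u ⟩ ∙ ⟨ a , p ⟩)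
        ≡⟨ cong₂ _∙_ (∙-diff a c (·-≢ʳ (p≢u ∘ sym) ∘ sym)) (∙-diff b a (p≢u ∘ sym)) ⟩
      ⟨ a xor c , p · (u · p) ⟩ ∙ ⟨ b xor a , u · p ⟩
        ≡⟨ cong (λ r → ⟨ a xor c , r ⟩ ∙ ⟨ b xor a , u · p ⟩) (inv-comm u p) ⟩
      ⟨ a xor c , u ⟩ ∙ ⟨ b xor a , u · p ⟩
        ≡⟨ ∙-diff (a xor c) (b xor a) u≢up ⟩
      ⟨ (a xor c) xor (b xor a) , u · (u · p) ⟩
        ≡⟨ cong (λ t → ⟨ t , u · (u · p) ⟩) ([a⊕c]⊕[b⊕a]≡b⊕c a b c) ⟩
      ⟨ b xor c , u · (u · p) ⟩
        ≡⟨ sym (∙-diff b c u≢up) ⟩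
      ⟨ b , u ⟩ ∙ ⟨ c , u · p ⟩ ∎
      where
      open ≡-Reasoning
      u≢up : u ≢ u · p
      u≢up = ·-≢ˡ (p≢u ∘ sym) ∘ sym

    generic : ∀ a b c u p q → IsVeblenPoint Q u → p ≢ u → q ≢ u → q ≢ p → q ≢ u · p →
      VeblenGoal b u ⟨ a , p ⟩ ⟨ c , q ⟩
    generic a b c u p q u-veblen p≢u q≢u q≢p q≢up = begin
      (⟨ a , p ⟩ ∙ ⟨ c , q ⟩) ∙ (⟨ b , u ⟩ ∙ ⟨ a , p ⟩)
        ≡⟨ cong₂ _∙_ (∙-diff a c (q≢p ∘ sym)) (∙-diff b a (p≢u ∘ sym)) ⟩
      ⟨ a xor c , p · q ⟩ ∙ ⟨ b xor a , u · p ⟩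
        ≡⟨ ∙-diff (a xor c) (b xor a) pq≢up ⟩
      ⟨ (a xor c) xor (b xor a) , (p · q) · (u · p) ⟩
        ≡⟨ cong₂ ⟨_,_⟩ ([a⊕c]⊕[b⊕a]≡b⊕c a b c) (u-veblen p q p≢u q≢u (q≢p ∘ sym) q≢up) ⟩
      ⟨ b xor c , u · q ⟩
        ≡⟨ sym (∙-diff b c (q≢u ∘ sym)) ⟩
      ⟨ b , u ⟩ ∙ ⟨ c , q ⟩ ∎
      where
      open ≡-Reasoning
      pq≢up : p · q ≢ u · p
      pq≢up e = q≢u (cancelˡ (trans e (comm u p)))

  veblen-lift : IsVeblenPoint Q u → ∀ b → IsVeblenPoint doubled ⟨ b , u ⟩
  veblen-lift _ b ∞ ∞ _ _ A≢C _ = ⊥-elim (A≢C refl)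
  veblen-lift {u} _ b ∞ ⟨ c , q ⟩ _ C≢x _ C≢x∞ with q ≟ u
  ... | yes refl = ⊥-elim (≢∧≢not⇒⊥ (bit-≢ C≢x ∘ sym) (bit-≢ C≢x∞))
  ... | no q≢u = trans (cong₂ ⟨_,_⟩ (trans (xor-annihilates-not c b) (xor-comm c b)) (comm q u))
    (sym (∙-diff b c (q≢u ∘ sym)))
  veblen-lift {u} _ b ⟨ a , p ⟩ ∞ A≢x _ _ ∞≢xA with p ≟ u
  ... | yes refl = ⊥-elim (∞≢xA (sym (trans (∙-same b a _) (same-≢ (bit-≢ A≢x ∘ sym)))))
  ... | no p≢u = trans (cong (⟨ not a , p ⟩ ∙_) (∙-diff b a (p≢u ∘ sym)))
    (trans (∙-diff (not a) (b xor a) (·-≢ʳ (p≢u ∘ sym) ∘ sym))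
           (cong₂ ⟨_,_⟩ (¬a⊕[b⊕a]≡¬b a b) (inv-comm u p)))
  veblen-lift {u} u-veblen b ⟨ a , p ⟩ ⟨ c , q ⟩ A≢x C≢x A≢C C≢xA with p ≟ u | q ≟ u | q ≟ p | q ≟ (u · p)
  ... | yes refl | _ | _ | _ = A-over-u a b c _ q (bit-≢ A≢x) C≢x A≢C
  ... | no p≢u | yes refl | _ | _ = C-over-u a b c _ p p≢u (bit-≢ C≢x)
  ... | no p≢u | no _ | yes refl | _ = C-over-A a b c u _ p≢u (bit-≢ A≢C)
  ... | no p≢u | no _ | no _ | yes refl = C-on-line-uA a b c u p p≢u
  ... | no p≢u | no q≢u | no q≢p | no q≢up = generic a b c u p q u-veblen p≢u q≢u q≢p q≢up


module Iteration where

  open Isomorphisms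
  open import Data.Nat using (zero; suc; _+_; _*_; _^_)
  open import Data.Nat.Properties using (*-identityʳ; *-assoc; *-comm; +-suc)
  open import Data.Fin.Properties using (_≟_)
  import Data.Maybe as Maybe
  open import Data.Maybe.Properties using (map-injective)
  open import Data.Product using (map₂)
  open import Data.Product.Properties using (,-injective)
  open import Function.Definitions using (Injective)

  record WithVeblenPoints (n M : ℕ) : Set where
    field
      quasigroup : SteinerQuasigroup (Fin n)
      veblenPoint : Fin M → Fin n
      veblenPoint-injective : Injective _≡_ _≡_ veblenPoint
      veblenPoint-isVeblen : ∀ i → IsVeblenPoint quasigroup (veblenPoint i)

  double : ∀ {n M} → WithVeblenPoints n M → WithVeblenPoints (suc (2 * n)) (suc (2 * M))
  double {n} {M} S = record
    { quasigroup = Transport.quasigroup doubling-↔ doubled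
    ; veblenPoint = from ∘ lift ∘ Inverse.to doubling-↔
    ; veblenPoint-injective = to-injective doubling-↔ ∘ map-injective (map₂-injective veblenPoint-injective)
                              ∘ from-injective doubling-↔
    ; veblenPoint-isVeblen = λ i → let x = Inverse.to doubling-↔ i in
        Transport.veblen doubling-↔ doubled (subst (IsVeblenPoint doubled) (sym (strictlyInverseˡ (lift x))) (lift-veblen x))
    }
    where
    open WithVeblenPoints S
    open Doubling _≟_ quasigroup
    open Inverse (doubling-↔ {n}) using (from; strictlyInverseˡ)

    lift : Maybe (Bool × Fin M) → Point
    lift = Maybe.map (map₂ veblenPoint)

    map₂-injective : ∀ {f : Fin M → Fin n} → Injective _≡_ _≡_ f → Injective _≡_ _≡_ (map₂ {A = Bool} f)
    map₂-injective f-injective e = let b≡ , i≡ = ,-injective e in cong₂ _,_ b≡ (f-injective i≡)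

    lift-veblen : ∀ x → IsVeblenPoint doubled (lift x)
    lift-veblen nothing = veblen-∞
    lift-veblen (just (b , i)) = veblen-lift (veblenPoint-isVeblen i) b

  doublings : ℕ → ℕ → ℕ
  doublings zero n = n
  doublings (suc t) n = suc (2 * doublings t n)

  suc-doublings : ∀ t n → suc (doublings t n) ≡ suc n * 2 ^ t
  suc-doublings zero n = sym (*-identityʳ (suc n))
  suc-doublings (suc t) n = begin
    suc (suc (2 * d))    ≡⟨ cong suc (sym (+-suc d (d + 0))) ⟩
    2 * suc d            ≡⟨ cong (2 *_) (suc-doublings t n) ⟩
    2 * (suc n * 2 ^ t)  ≡⟨ sym (*-assoc 2 (suc n) (2 ^ t)) ⟩
    2 * suc n * 2 ^ t    ≡⟨ cong (_* 2 ^ t) (*-comm 2 (suc n)) ⟩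
    suc n * 2 * 2 ^ t    ≡⟨ *-assoc (suc n) 2 (2 ^ t) ⟩
    suc n * 2 ^ suc t    ∎
    where
    open ≡-Reasoning
    d = doublings t n

  iterate-double : ∀ t {n M} → WithVeblenPoints n M → WithVeblenPoints (doublings t n) (doublings t M)
  iterate-double zero S = S
  iterate-double (suc t) S = double (iterate-double t S)

  noVeblenPoints : ∀ {n} → SteinerQuasigroup (Fin n) → WithVeblenPoints n 0
  noVeblenPoints Q = record
    { quasigroup = Q ; veblenPoint = λ () ; veblenPoint-injective = λ {} ; veblenPoint-isVeblen = λ () }


module Mod3 where

  open import Data.Fin using (zero; suc)

  next : Fin 3 → Fin 3
  next zero = suc zero
  next (suc zero) = suc (suc zero)
  next (suc (suc zero)) = zero

  prev : Fin 3 → Fin 3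
  prev zero = suc (suc zero)
  prev (suc zero) = zero
  prev (suc (suc zero)) = suc zero

  next-prev : ∀ i → next (prev i) ≡ i
  next-prev zero = refl
  next-prev (suc zero) = refl
  next-prev (suc (suc zero)) = refl

  prev-next : ∀ i → prev (next i) ≡ i
  prev-next zero = refl
  prev-next (suc zero) = refl
  prev-next (suc (suc zero)) = refl

  prev-prev : ∀ i → prev (prev i) ≡ next i
  prev-prev zero = refl
  prev-prev (suc zero) = refl
  prev-prev (suc (suc zero)) = refl

  next-next : ∀ i → next (next i) ≡ prev i
  next-next zero = refl
  next-next (suc zero) = refl
  next-next (suc (suc zero)) = refl

  data Position (i j : Fin 3) : Set where
    same : j ≡ i → Position i j
    ahead : j ≡ next i → Position i j
    behind : i ≡ next j → Position i j

  position : ∀ i j → Position i j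
  position zero zero = same refl
  position zero (suc zero) = ahead refl
  position zero (suc (suc zero)) = behind refl
  position (suc zero) zero = behind refl
  position (suc zero) (suc zero) = same refl
  position (suc zero) (suc (suc zero)) = ahead refl
  position (suc (suc zero)) zero = ahead refl
  position (suc (suc zero)) (suc zero) = behind refl
  position (suc (suc zero)) (suc (suc zero)) = same refl


record IdempotentCommutativeQuasigroup (Z : Set) : Set where
  infix 4 _≟_
  infixl 7 _⋆_ _\\_
  field
    _≟_ : DecidableEquality Z
    _⋆_ : Z → Z → Z
    _\\_ : Z → Z → Z
    comm : ∀ x y → x ⋆ y ≡ y ⋆ x
    idem : ∀ x → x ⋆ x ≡ x
    leftDividesˡ : ∀ x y → x ⋆ (x \\ y) ≡ y
    leftDividesʳ : ∀ x y → x \\ (x ⋆ y) ≡ y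


-- Bose's construction: the blocks are {(x , 0), (x , 1), (x , 2)} and
-- {(x , i), (y , i), (x ⋆ y , i + 1)} for x ≢ y.
module Bose {Z : Set} (C : IdempotentCommutativeQuasigroup Z) where

  open IdempotentCommutativeQuasigroup C
  open Mod3
  open import Data.Fin using (zero; suc)

  Point : Set
  Point = Z × Fin 3

  level : Z → Z → Fin 3 → Point
  level x y i with x ≟ y
  ... | yes _ = x , i
  ... | no _ = x ⋆ y , next i

  rise : Z → Fin 3 → Z → Point
  rise x i z with x \\ z ≟ x
  ... | yes _ = x , prev i
  ... | no _ = x \\ z , i

  infixl 7 _·_
  _·_ : Point → Point → Point
  (x , zero) · (y , zero) = level x y zero
  (x , zero) · (y , suc zero) = rise x zero y
  (x , zero) · (y , suc (suc zero)) = rise y (suc (suc zero)) x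
  (x , suc zero) · (y , zero) = rise y zero x
  (x , suc zero) · (y , suc zero) = level x y (suc zero)
  (x , suc zero) · (y , suc (suc zero)) = rise x (suc zero) y
  (x , suc (suc zero)) · (y , zero) = rise x (suc (suc zero)) y
  (x , suc (suc zero)) · (y , suc zero) = rise y (suc zero) x
  (x , suc (suc zero)) · (y , suc (suc zero)) = level x y (suc (suc zero))

  ·-level : ∀ x y i → (x , i) · (y , i) ≡ level x y i
  ·-level x y zero = refl
  ·-level x y (suc zero) = refl
  ·-level x y (suc (suc zero)) = refl

  ·-rise : ∀ x z i → (x , i) · (z , next i) ≡ rise x i z
  ·-rise x z zero = refl
  ·-rise x z (suc zero) = refl
  ·-rise x z (suc (suc zero)) = refl

  ·-fall : ∀ x z j → (x , next j) · (z , j) ≡ rise z j x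
  ·-fall x z zero = refl
  ·-fall x z (suc zero) = refl
  ·-fall x z (suc (suc zero)) = refl

  \\-self : ∀ x → x \\ x ≡ x
  \\-self x = trans (cong (x \\_) (sym (idem x))) (leftDividesʳ x x)

  \\-swap : ∀ x z → (z \\ x) \\ x ≡ z
  \\-swap x z = trans (cong ((z \\ x) \\_) (trans (sym (leftDividesˡ z x)) (comm z (z \\ x))))
                      (leftDividesʳ (z \\ x) z)

  level-self : ∀ x i → level x x i ≡ (x , i)
  level-self x i with x ≟ x
  ... | yes _ = refl
  ... | no x≢x = ⊥-elim (x≢x refl)

  level-comm : ∀ x y i → level x y i ≡ level y x i
  level-comm x y i with x ≟ y | y ≟ x
  ... | yes refl | yes _ = refl
  ... | yes x≡y | no y≢x = ⊥-elim (y≢x (sym x≡y))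
  ... | no x≢y | yes y≡x = ⊥-elim (x≢y (sym y≡x))
  ... | no _ | no _ = cong (_, next i) (comm x y)

  ·-idem : ∀ p → p · p ≡ p
  ·-idem (x , i) = trans (·-level x x i) (level-self x i)

  ·-comm : ∀ p q → p · q ≡ q · p
  ·-comm (x , i) (y , j) with position i j
  ... | same refl = trans (·-level x y i) (trans (level-comm x y i) (sym (·-level y x i)))
  ... | ahead refl = trans (·-rise x y i) (sym (·-fall y x i))
  ... | behind refl = trans (·-fall x y j) (sym (·-rise y x j))

  inv-level : ∀ x y i → (x , i) · level x y i ≡ (y , i)
  inv-level x y i with x ≟ y
  ... | yes refl = ·-idem (x , i)
  ... | no x≢y = trans (·-rise x (x ⋆ y) i) rise-xy
    where
    rise-xy : rise x i (x ⋆ y) ≡ (y , i)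
    rise-xy with x \\ (x ⋆ y) ≟ x
    ... | yes e = ⊥-elim (x≢y (sym (trans (sym (leftDividesʳ x y)) e)))
    ... | no _ = cong (_, i) (leftDividesʳ x y)

  inv-rise : ∀ x i z → (x , i) · rise x i z ≡ (z , next i)
  inv-rise x i z with x \\ z ≟ x
  ... | yes e = begin
    (x , i) · (x , prev i)     ≡⟨ cong (λ k → (x , k) · (x , prev i)) (sym (next-prev i)) ⟩
    (x , next (prev i)) · (x , prev i) ≡⟨ ·-fall x x (prev i) ⟩
    rise x (prev i) x          ≡⟨ rise-self ⟩
    (x , prev (prev i))        ≡⟨ cong₂ _,_ x≡z (prev-prev i) ⟩
    (z , next i)               ∎
    where
    open ≡-Reasoning
    x≡z : x ≡ z
    x≡z = trans (sym (idem x)) (trans (cong (x ⋆_) (sym e)) (leftDividesˡ x z))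
    rise-self : rise x (prev i) x ≡ (x , prev (prev i))
    rise-self with x \\ x ≟ x
    ... | yes _ = refl
    ... | no x\\x≢x = ⊥-elim (x\\x≢x (\\-self x))
  ... | no x\\z≢x = trans (·-level x (x \\ z) i) level-x
    where
    level-x : level x (x \\ z) i ≡ (z , next i)
    level-x with x ≟ x \\ z
    ... | yes e = ⊥-elim (x\\z≢x (sym e))
    ... | no _ = cong (_, next i) (leftDividesˡ x z)

  inv-fall : ∀ x j z → (x , next j) · rise z j x ≡ (z , j)
  inv-fall x j z with z \\ x ≟ z
  ... | yes e = begin
    (x , next j) · (z , prev j)              ≡⟨ cong (λ k → (x , next j) · (z , k)) (sym (next-next j)) ⟩
    (x , next j) · (z , next (next j))       ≡⟨ ·-rise x z (next j) ⟩
    rise x (next j) z                        ≡⟨ rise-self ⟩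
    (x , prev (next j))                      ≡⟨ cong₂ _,_ (sym z≡x) (prev-next j) ⟩
    (z , j)                                  ∎
    where
    open ≡-Reasoning
    z≡x : z ≡ x
    z≡x = trans (sym (idem z)) (trans (cong (z ⋆_) (sym e)) (leftDividesˡ z x))
    rise-self : rise x (next j) z ≡ (x , prev (next j))
    rise-self with x \\ z ≟ x
    ... | yes _ = refl
    ... | no x\\z≢x = ⊥-elim (x\\z≢x (trans (cong (x \\_) z≡x) (\\-self x)))
  ... | no z\\x≢z = trans (·-fall x (z \\ x) j) rise-z
    where
    rise-z : rise (z \\ x) j x ≡ (z , j)
    rise-z with (z \\ x) \\ x ≟ z \\ x
    ... | yes e = ⊥-elim (z\\x≢z (trans (sym e) (\\-swap x z)))
    ... | no _ = cong (_, j) (\\-swap x z)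

  ·-inv : ∀ p q → p · (p · q) ≡ q
  ·-inv (x , i) (y , j) with position i j
  ... | same refl = trans (cong ((x , i) ·_) (·-level x y i)) (inv-level x y i)
  ... | ahead refl = trans (cong ((x , i) ·_) (·-rise x y i)) (inv-rise x i y)
  ... | behind refl = trans (cong ((x , next j) ·_) (·-fall x y j)) (inv-fall x j y)

  quasigroup : SteinerQuasigroup Point
  quasigroup = record { _·_ = _·_ ; idem = ·-idem ; comm = ·-comm ; inv = ·-inv }


-- Z is split into a low and a high half by isHigh: squaring fixes the low half and is a
-- bijection from the high half onto the low half, with inverse partner.
record HalfIdempotentCommutativeQuasigroup (Z : Set) : Set where
  infix 4 _≟_
  infixl 7 _⋆_ _\\_
  field
    _≟_ : DecidableEquality Z
    _⋆_ : Z → Z → Z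
    _\\_ : Z → Z → Z
    comm : ∀ x y → x ⋆ y ≡ y ⋆ x
    leftDividesˡ : ∀ x y → x ⋆ (x \\ y) ≡ y
    leftDividesʳ : ∀ x y → x \\ (x ⋆ y) ≡ y
    isHigh : Z → Bool
    partner : Z → Z
    low-idem : ∀ x → isHigh x ≡ false → x ⋆ x ≡ x
    high-square-low : ∀ x → isHigh x ≡ true → isHigh (x ⋆ x) ≡ false
    partner-high : ∀ x → isHigh x ≡ false → isHigh (partner x) ≡ true
    partner-square : ∀ x → isHigh x ≡ false → partner x ⋆ partner x ≡ x
    square-partner : ∀ x → isHigh x ≡ true → partner (x ⋆ x) ≡ x


-- Skolem's construction on Z × Fin 3 and a point ∞: the blocks are
-- {(x , 0), (x , 1), (x , 2)} for low x, {∞, (h , i), (h ⋆ h , i + 1)} for high h and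
-- {(x , i), (y , i), (x ⋆ y , i + 1)} for x ≢ y.
module Skolem {Z : Set} (C : HalfIdempotentCommutativeQuasigroup Z) where

  open HalfIdempotentCommutativeQuasigroup C
  open Mod3
  open import Data.Fin using (zero; suc)

  Point : Set
  Point = Maybe (Z × Fin 3)

  pattern ∞ = nothing
  pattern ⟨_,_⟩ x i = just (x , i)

  opposite∞′ : Z → Fin 3 → Bool → Point
  opposite∞′ x i true = ⟨ x ⋆ x , next i ⟩
  opposite∞′ x i false = ⟨ partner x , prev i ⟩

  opposite∞ : Z → Fin 3 → Point
  opposite∞ x i = opposite∞′ x i (isHigh x)

  diagonal : Z → Fin 3 → Bool → Point
  diagonal x i true = ∞
  diagonal x i false = ⟨ x , prev i ⟩

  level : Z → Z → Fin 3 → Point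
  level x y i with x ≟ y
  ... | yes _ = ⟨ x , i ⟩
  ... | no _ = ⟨ x ⋆ y , next i ⟩

  rise : Z → Fin 3 → Z → Point
  rise x i z with x \\ z ≟ x
  ... | yes _ = diagonal x i (isHigh x)
  ... | no _ = ⟨ x \\ z , i ⟩

  infixl 7 _·_
  _·_ : Point → Point → Point
  ∞ · ∞ = ∞
  ∞ · ⟨ x , i ⟩ = opposite∞ x i
  ⟨ x , i ⟩ · ∞ = opposite∞ x i
  ⟨ x , zero ⟩ · ⟨ y , zero ⟩ = level x y zero
  ⟨ x , zero ⟩ · ⟨ y , suc zero ⟩ = rise x zero y
  ⟨ x , zero ⟩ · ⟨ y , suc (suc zero) ⟩ = rise y (suc (suc zero)) x
  ⟨ x , suc zero ⟩ · ⟨ y , zero ⟩ = rise y zero x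
  ⟨ x , suc zero ⟩ · ⟨ y , suc zero ⟩ = level x y (suc zero)
  ⟨ x , suc zero ⟩ · ⟨ y , suc (suc zero) ⟩ = rise x (suc zero) y
  ⟨ x , suc (suc zero) ⟩ · ⟨ y , zero ⟩ = rise x (suc (suc zero)) y
  ⟨ x , suc (suc zero) ⟩ · ⟨ y , suc zero ⟩ = rise y (suc zero) x
  ⟨ x , suc (suc zero) ⟩ · ⟨ y , suc (suc zero) ⟩ = level x y (suc (suc zero))

  ·-level : ∀ x y i → ⟨ x , i ⟩ · ⟨ y , i ⟩ ≡ level x y i
  ·-level x y zero = refl
  ·-level x y (suc zero) = refl
  ·-level x y (suc (suc zero)) = refl

  ·-rise : ∀ x z i → ⟨ x , i ⟩ · ⟨ z , next i ⟩ ≡ rise x i z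
  ·-rise x z zero = refl
  ·-rise x z (suc zero) = refl
  ·-rise x z (suc (suc zero)) = refl

  ·-fall : ∀ x z j → ⟨ x , next j ⟩ · ⟨ z , j ⟩ ≡ rise z j x
  ·-fall x z zero = refl
  ·-fall x z (suc zero) = refl
  ·-fall x z (suc (suc zero)) = refl

  ·-fall′ : ∀ x z i → ⟨ x , i ⟩ · ⟨ z , prev i ⟩ ≡ rise z (prev i) x
  ·-fall′ x z i = subst (λ k → ⟨ x , k ⟩ · ⟨ z , prev i ⟩ ≡ rise z (prev i) x) (next-prev i) (·-fall x z (prev i))

  ·-rise′ : ∀ x z j → ⟨ x , next j ⟩ · ⟨ z , prev j ⟩ ≡ rise x (next j) z
  ·-rise′ x z j = subst (λ k → ⟨ x , next j ⟩ · ⟨ z , k ⟩ ≡ rise x (next j) z) (next-next j) (·-rise x z (next j))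

  level-self : ∀ x i → level x x i ≡ ⟨ x , i ⟩
  level-self x i with x ≟ x
  ... | yes _ = refl
  ... | no x≢x = ⊥-elim (x≢x refl)

  level-≢ : ∀ x y i → x ≢ y → level x y i ≡ ⟨ x ⋆ y , next i ⟩
  level-≢ x y i x≢y with x ≟ y
  ... | yes x≡y = ⊥-elim (x≢y x≡y)
  ... | no _ = refl

  level-comm : ∀ x y i → level x y i ≡ level y x i
  level-comm x y i with x ≟ y | y ≟ x
  ... | yes refl | yes _ = refl
  ... | yes x≡y | no y≢x = ⊥-elim (y≢x (sym x≡y))
  ... | no x≢y | yes y≡x = ⊥-elim (x≢y (sym y≡x))
  ... | no _ | no _ = cong ⟨_, next i ⟩ (comm x y)

  rise-diagonal : ∀ x i z → x \\ z ≡ x → rise x i z ≡ diagonal x i (isHigh x)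
  rise-diagonal x i z e with x \\ z ≟ x
  ... | yes _ = refl
  ... | no x\\z≢x = ⊥-elim (x\\z≢x e)

  rise-≢ : ∀ x i z → x \\ z ≢ x → rise x i z ≡ ⟨ x \\ z , i ⟩
  rise-≢ x i z x\\z≢x with x \\ z ≟ x
  ... | yes e = ⊥-elim (x\\z≢x e)
  ... | no _ = refl

  \\-swap : ∀ x z → (z \\ x) \\ x ≡ z
  \\-swap x z = trans (cong ((z \\ x) \\_) (trans (sym (leftDividesˡ z x)) (comm z (z \\ x))))
                      (leftDividesʳ (z \\ x) z)

  ·-idem : ∀ p → p · p ≡ p
  ·-idem ∞ = refl
  ·-idem ⟨ x , i ⟩ = trans (·-level x x i) (level-self x i)

  ·-comm : ∀ p q → p · q ≡ q · p
  ·-comm ∞ ∞ = refl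
  ·-comm ∞ ⟨ _ , _ ⟩ = refl
  ·-comm ⟨ _ , _ ⟩ ∞ = refl
  ·-comm ⟨ x , i ⟩ ⟨ y , j ⟩ with position i j
  ... | same refl = trans (·-level x y i) (trans (level-comm x y i) (sym (·-level y x i)))
  ... | ahead refl = trans (·-rise x y i) (sym (·-fall y x i))
  ... | behind refl = trans (·-fall x y j) (sym (·-rise y x j))

  inv-∞ : ∀ x i b → isHigh x ≡ b → ∞ · opposite∞′ x i b ≡ ⟨ x , i ⟩
  inv-∞ x i true high = trans (cong (opposite∞′ (x ⋆ x) (next i)) (high-square-low x high))
    (cong₂ ⟨_,_⟩ (square-partner x high) (prev-next i))
  inv-∞ x i false low = trans (cong (opposite∞′ (partner x) (prev i)) (partner-high x low))
    (cong₂ ⟨_,_⟩ (partner-square x low) (next-prev i))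

  inv-opposite∞ : ∀ x i b → isHigh x ≡ b → ⟨ x , i ⟩ · opposite∞′ x i b ≡ ∞
  inv-opposite∞ x i true high = trans (·-rise x (x ⋆ x) i)
    (trans (rise-diagonal x i (x ⋆ x) (leftDividesʳ x x)) (cong (diagonal x i) high))
  inv-opposite∞ x i false low = trans (·-fall′ x (partner x) i)
    (trans (rise-diagonal (partner x) (prev i) x
             (trans (cong (partner x \\_) (sym (partner-square x low))) (leftDividesʳ (partner x) (partner x))))
           (cong (diagonal (partner x) (prev i)) (partner-high x low)))

  inv-level : ∀ x y i → ⟨ x , i ⟩ · level x y i ≡ ⟨ y , i ⟩
  inv-level x y i with x ≟ y
  ... | yes refl = ·-idem ⟨ x , i ⟩
  ... | no x≢y = trans (·-rise x (x ⋆ y) i)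
    (trans (rise-≢ x i (x ⋆ y) (λ e → x≢y (sym (trans (sym (leftDividesʳ x y)) e))))
           (cong ⟨_, i ⟩ (leftDividesʳ x y)))

  inv-diagonal : ∀ x i z → x \\ z ≡ x → ∀ b → isHigh x ≡ b → ⟨ x , i ⟩ · diagonal x i b ≡ ⟨ z , next i ⟩
  inv-diagonal x i z e true high =
    trans (cong (opposite∞′ x i) high) (cong ⟨_, next i ⟩ (trans (cong (x ⋆_) (sym e)) (leftDividesˡ x z)))
  inv-diagonal x i z e false low = trans (·-fall′ x x i) (trans (rise-diagonal x (prev i) x x\\x≡x)
    (trans (cong (diagonal x (prev i)) low) (cong₂ ⟨_,_⟩ x≡z (prev-prev i))))
    where
    x\\x≡x : x \\ x ≡ x
    x\\x≡x = trans (cong (x \\_) (sym (low-idem x low))) (leftDividesʳ x x)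
    x≡z : x ≡ z
    x≡z = trans (sym (low-idem x low)) (trans (cong (x ⋆_) (sym e)) (leftDividesˡ x z))

  inv-rise : ∀ x i z → ⟨ x , i ⟩ · rise x i z ≡ ⟨ z , next i ⟩
  inv-rise x i z with x \\ z ≟ x
  ... | yes e = inv-diagonal x i z e (isHigh x) refl
  ... | no x\\z≢x = trans (·-level x (x \\ z) i)
    (trans (level-≢ x (x \\ z) i (x\\z≢x ∘ sym)) (cong ⟨_, next i ⟩ (leftDividesˡ x z)))

  inv-diagonal′ : ∀ x j z → z \\ x ≡ z → ∀ b → isHigh z ≡ b → ⟨ x , next j ⟩ · diagonal z j b ≡ ⟨ z , j ⟩
  inv-diagonal′ x j z e true high =
    trans (cong (opposite∞′ x (next j)) (trans (cong isHigh (sym z⋆z≡x)) (high-square-low z high)))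
          (cong₂ ⟨_,_⟩ (trans (cong partner (sym z⋆z≡x)) (square-partner z high)) (prev-next j))
    where
    z⋆z≡x : z ⋆ z ≡ x
    z⋆z≡x = trans (cong (z ⋆_) (sym e)) (leftDividesˡ z x)
  inv-diagonal′ x j z e false low = trans (·-rise′ x z j) (trans (rise-diagonal x (next j) z x\\z≡x)
    (trans (cong (diagonal x (next j)) (trans (cong isHigh (sym z≡x)) low)) (cong₂ ⟨_,_⟩ (sym z≡x) (prev-next j))))
    where
    z≡x : z ≡ x
    z≡x = trans (sym (low-idem z low)) (trans (cong (z ⋆_) (sym e)) (leftDividesˡ z x))
    x\\z≡x : x \\ z ≡ x
    x\\z≡x = trans (cong (_\\ z) (sym z≡x)) (trans (cong (z \\_) (sym (low-idem z low))) (trans (leftDividesʳ z z) z≡x))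

  inv-fall : ∀ x j z → ⟨ x , next j ⟩ · rise z j x ≡ ⟨ z , j ⟩
  inv-fall x j z with z \\ x ≟ z
  ... | yes e = inv-diagonal′ x j z e (isHigh z) refl
  ... | no z\\x≢z = trans (·-fall x (z \\ x) j)
    (trans (rise-≢ (z \\ x) j x (λ e → z\\x≢z (trans (sym e) (\\-swap x z)))) (cong ⟨_, j ⟩ (\\-swap x z)))

  ·-inv : ∀ p q → p · (p · q) ≡ q
  ·-inv ∞ ∞ = refl
  ·-inv ∞ ⟨ x , i ⟩ = inv-∞ x i (isHigh x) refl
  ·-inv ⟨ x , i ⟩ ∞ = inv-opposite∞ x i (isHigh x) refl
  ·-inv ⟨ x , i ⟩ ⟨ y , j ⟩ with position i j
  ... | same refl = trans (cong (⟨ x , i ⟩ ·_) (·-level x y i)) (inv-level x y i)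
  ... | ahead refl = trans (cong (⟨ x , i ⟩ ·_) (·-rise x y i)) (inv-rise x i y)
  ... | behind refl = trans (cong (⟨ x , next j ⟩ ·_) (·-fall x y j)) (inv-fall x j y)

  quasigroup : SteinerQuasigroup Point
  quasigroup = record { _·_ = _·_ ; idem = ·-idem ; comm = ·-comm ; inv = ·-inv }


module Residues (m : ℕ) .{{_ : NonZero m}} where

  open import Data.Nat using (_+_; _*_; _∸_; _%_; _<_)
  open import Data.Nat.Properties using (m+[n∸m]≡n; <⇒≤)
  open import Data.Nat.DivMod
    using (m%n<n; %-distribˡ-+; %-distribˡ-*; m%n%n≡m%n; [m+n]%n≡m%n; [m+kn]%n≡m%n; m<n⇒m%n≡m)
  open import Data.Fin using (toℕ; fromℕ<)
  open import Data.Fin.Properties using (toℕ-fromℕ<; toℕ-injective; toℕ<n)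
  open import Relation.Binary.Bundles using (Setoid)
  open import Level using (0ℓ)
  import Relation.Binary.Reasoning.Setoid as SetoidReasoning

  -- A record rather than a % m ≡ b % m, so that a and b can be recovered by unification.
  infix 4 _≈_
  record _≈_ (a b : ℕ) : Set where
    constructor mk≈
    field ≈⇒%≡ : a % m ≡ b % m

  open _≈_

  ≈-refl : ∀ {a} → a ≈ a
  ≈-refl = mk≈ refl

  ≈-setoid : Setoid 0ℓ 0ℓ
  ≈-setoid = record
    { Carrier = ℕ ; _≈_ = _≈_
    ; isEquivalence = record
      { refl = ≈-refl
      ; sym = λ a≈b → mk≈ (sym (≈⇒%≡ a≈b))
      ; trans = λ a≈b b≈c → mk≈ (trans (≈⇒%≡ a≈b) (≈⇒%≡ b≈c)) } }

  module ≈-Reasoning = SetoidReasoning ≈-setoid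

  ⟦_⟧ : ℕ → Fin m
  ⟦ a ⟧ = fromℕ< (m%n<n a m)

  toℕ-⟦⟧ : ∀ a → toℕ ⟦ a ⟧ ≈ a
  toℕ-⟦⟧ a = mk≈ (trans (cong (_% m) (toℕ-fromℕ< (m%n<n a m))) (m%n%n≡m%n a m))

  toℕ-⟦⟧-< : ∀ {a} → a < m → toℕ ⟦ a ⟧ ≡ a
  toℕ-⟦⟧-< {a} a<m = trans (toℕ-fromℕ< (m%n<n a m)) (m<n⇒m%n≡m a<m)

  ⟦⟧-≈ : ∀ {a} {x : Fin m} → a ≈ toℕ x → ⟦ a ⟧ ≡ x
  ⟦⟧-≈ {a} {x} a≈x =
    toℕ-injective (trans (toℕ-fromℕ< (m%n<n a m)) (trans (≈⇒%≡ a≈x) (m<n⇒m%n≡m (toℕ<n x))))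

  +-cong : ∀ {a a′ b b′} → a ≈ a′ → b ≈ b′ → a + b ≈ a′ + b′
  +-cong {a} {a′} {b} {b′} (mk≈ a≈) (mk≈ b≈) =
    mk≈ (trans (%-distribˡ-+ a b m) (trans (cong₂ (λ u w → (u + w) % m) a≈ b≈) (sym (%-distribˡ-+ a′ b′ m))))

  *-cong : ∀ {a a′ b b′} → a ≈ a′ → b ≈ b′ → a * b ≈ a′ * b′
  *-cong {a} {a′} {b} {b′} (mk≈ a≈) (mk≈ b≈) =
    mk≈ (trans (%-distribˡ-* a b m) (trans (cong₂ (λ u w → (u * w) % m) a≈ b≈) (sym (%-distribˡ-* a′ b′ m))))

  +-*m : ∀ a k → a + k * m ≈ a
  +-*m a k = mk≈ ([m+kn]%n≡m%n a k m)

  +-m : ∀ a → a + m ≈ a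
  +-m a = mk≈ ([m+n]%n≡m%n a m)

  toℕ+[m∸toℕ]≡m : ∀ (x : Fin m) → toℕ x + (m ∸ toℕ x) ≡ m
  toℕ+[m∸toℕ]≡m x = m+[n∸m]≡n (<⇒≤ (toℕ<n x))


-- On ℤ/m with m = 2q + 1 odd, x ⋆ y = (x + y) / 2, i.e. (x + y) (q + 1), and x \\ z = 2 z - x.
module CyclicOdd (q : ℕ) where

  open import Data.Nat using (suc; _+_; _*_; _∸_)
  open import Data.Nat.Properties using (+-comm; +-assoc; +-commutativeSemigroup)
  open import Algebra.Properties.CommutativeSemigroup +-commutativeSemigroup using (x∙yz≈y∙xz)
  open import Data.Nat.Tactic.RingSolver using (solve-∀)
  open import Data.Fin using (toℕ)
  open import Data.Fin.Properties using (_≟_)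

  m : ℕ
  m = suc (q + q)

  open Residues m

  infixl 7 _⋆_ _\\_
  _⋆_ : Fin m → Fin m → Fin m
  x ⋆ y = ⟦ (toℕ x + toℕ y) * suc q ⟧

  _\\_ : Fin m → Fin m → Fin m
  x \\ z = ⟦ toℕ z + toℕ z + (m ∸ toℕ x) ⟧

  private
    [a+a]*h≡a+a*m : ∀ a q → (a + a) * suc q ≡ a + a * suc (q + q)
    [a+a]*h≡a+a*m = solve-∀

    [a+b]*h+[a+b]*h+d≡b+[a+d]+[a+b]*m : ∀ a b d q →
      (a + b) * suc q + (a + b) * suc q + d ≡ b + (a + d) + (a + b) * suc (q + q)
    [a+b]*h+[a+b]*h+d≡b+[a+d]+[a+b]*m = solve-∀

    [z+z+m]*h≡z+[z+h]*m : ∀ z q → (z + z + suc (q + q)) * suc q ≡ z + (z + suc q) * suc (q + q)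
    [z+z+m]*h≡z+[z+h]*m = solve-∀

  ⋆-idem : ∀ x → x ⋆ x ≡ x
  ⋆-idem x = ⟦⟧-≈ (begin
    (X + X) * suc q ≡⟨ [a+a]*h≡a+a*m X q ⟩
    X + X * m       ≈⟨ +-*m X X ⟩
    X               ∎)
    where
    open ≈-Reasoning
    X = toℕ x

  ⋆-\\ : ∀ x z → x ⋆ (x \\ z) ≡ z
  ⋆-\\ x z = ⟦⟧-≈ (begin
    (X + toℕ (x \\ z)) * suc q    ≈⟨ *-cong (+-cong (≈-refl {X}) (toℕ-⟦⟧ (Z + Z + d))) (≈-refl {suc q}) ⟩
    (X + (Z + Z + d)) * suc q     ≡⟨ cong (_* suc q) (x∙yz≈y∙xz X (Z + Z) d) ⟩
    (Z + Z + (X + d)) * suc q     ≡⟨ cong (λ w → (Z + Z + w) * suc q) (toℕ+[m∸toℕ]≡m x) ⟩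
    (Z + Z + m) * suc q           ≡⟨ [z+z+m]*h≡z+[z+h]*m Z q ⟩
    Z + (Z + suc q) * m           ≈⟨ +-*m Z (Z + suc q) ⟩
    Z                             ∎)
    where
    open ≈-Reasoning
    X = toℕ x
    Z = toℕ z
    d = m ∸ X

  \\-⋆ : ∀ x y → x \\ (x ⋆ y) ≡ y
  \\-⋆ x y = ⟦⟧-≈ (begin
    S′ + S′ + d                             ≈⟨ +-cong (+-cong (toℕ-⟦⟧ S) (toℕ-⟦⟧ S)) (≈-refl {d}) ⟩
    S + S + d                               ≡⟨ [a+b]*h+[a+b]*h+d≡b+[a+d]+[a+b]*m X Y d q ⟩
    Y + (X + d) + (X + Y) * m               ≡⟨ cong (λ w → Y + w + (X + Y) * m) (toℕ+[m∸toℕ]≡m x) ⟩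
    Y + m + (X + Y) * m                     ≡⟨ +-assoc Y m ((X + Y) * m) ⟩
    Y + suc (X + Y) * m                     ≈⟨ +-*m Y (suc (X + Y)) ⟩
    Y                                       ∎)
    where
    open ≈-Reasoning
    X = toℕ x
    Y = toℕ y
    S = (X + Y) * suc q
    S′ = toℕ (x ⋆ y)
    d = m ∸ X

  quasigroup : IdempotentCommutativeQuasigroup (Fin m)
  quasigroup = record
    { _≟_ = _≟_ ; _⋆_ = _⋆_ ; _\\_ = _\\_
    ; comm = λ x y → cong (λ s → ⟦ s * suc q ⟧) (+-comm (toℕ x) (toℕ y))
    ; idem = ⋆-idem ; leftDividesˡ = ⋆-\\ ; leftDividesʳ = \\-⋆ }


module Parity where

  open import Data.Nat using (zero; suc; _+_; ⌊_/2⌋)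
  open import Data.Nat.Properties using (+-suc)

  parity : ℕ → ℕ
  parity zero = 0
  parity (suc zero) = 1
  parity (suc (suc s)) = parity s

  even⇒⌊/2⌋+⌊/2⌋≡ : ∀ s → parity s ≡ 0 → ⌊ s /2⌋ + ⌊ s /2⌋ ≡ s
  even⇒⌊/2⌋+⌊/2⌋≡ zero _ = refl
  even⇒⌊/2⌋+⌊/2⌋≡ (suc (suc s)) even =
    cong suc (trans (+-suc ⌊ s /2⌋ ⌊ s /2⌋) (cong suc (even⇒⌊/2⌋+⌊/2⌋≡ s even)))

  odd⇒suc[⌊/2⌋+⌊/2⌋]≡ : ∀ s → parity s ≡ 1 → suc (⌊ s /2⌋ + ⌊ s /2⌋) ≡ s
  odd⇒suc[⌊/2⌋+⌊/2⌋]≡ (suc zero) _ = refl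
  odd⇒suc[⌊/2⌋+⌊/2⌋]≡ (suc (suc s)) odd =
    cong (suc ∘ suc) (trans (+-suc ⌊ s /2⌋ ⌊ s /2⌋) (odd⇒suc[⌊/2⌋+⌊/2⌋]≡ s odd))

  parity≡0⊎1 : ∀ s → parity s ≡ 0 ⊎ parity s ≡ 1
  parity≡0⊎1 zero = inj₁ refl
  parity≡0⊎1 (suc zero) = inj₂ refl
  parity≡0⊎1 (suc (suc s)) = parity≡0⊎1 s

  parity-double : ∀ a → parity (a + a) ≡ 0
  parity-double zero = refl
  parity-double (suc a) = trans (cong (parity ∘ suc) (+-suc a a)) (parity-double a)

  parity-suc-double : ∀ a → parity (suc (a + a)) ≡ 1
  parity-suc-double zero = refl
  parity-suc-double (suc a) = trans (cong (parity ∘ suc ∘ suc) (+-suc a a)) (parity-suc-double a)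


-- On ℤ/m with m = 2n, x ⋆ y = halve (x + y), where halve sends 2a to a and 2a + 1 to a + n;
-- x \\ z = unhalve z - x. The low half is [0, n) and the partner of a low x is x + n.
module CyclicEven (p : ℕ) where

  open Parity
  open import Data.Nat using (suc; _+_; _*_; _∸_; _%_; _<_; _≤_; _<?_; _≤?_; ⌊_/2⌋; s≤s)
  import Data.Nat.Properties as ℕ
  open import Data.Nat.DivMod using (m%n<n; m%n%n≡m%n; m<n⇒m%n≡m)
  open import Data.Nat.Tactic.RingSolver using (solve-∀)
  open import Data.Fin using (toℕ)
  open import Data.Fin.Properties using (_≟_; toℕ-injective; toℕ<n)
  open import Algebra.Properties.CommutativeSemigroup ℕ.+-commutativeSemigroup using (x∙yz≈y∙xz; xy∙z≈y∙xz)
  open import Relation.Nullary.Decidable using (isYes; isYes≗does; dec-true; dec-false; toWitness; toWitnessFalse)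
  open import Data.Bool using (T; not)
  open import Data.Unit using (tt)

  n : ℕ
  n = suc p

  m : ℕ
  m = n + n

  open Residues m
  open _≈_

  halve : ℕ → ℕ
  halve s = ⌊ s /2⌋ + parity s * n

  unhalve : ℕ → ℕ
  unhalve c with c <? n
  ... | yes _ = c + c
  ... | no _ = suc ((c ∸ n) + (c ∸ n))

  private
    double-< : ∀ {a} → a < n → a + a < m
    double-< a<n = ℕ.+-mono-< a<n a<n

    suc-double-< : ∀ {a} → a < n → suc (a + a) < m
    suc-double-< {a} a<n = subst (_≤ m) (cong suc (ℕ.+-suc a a)) (ℕ.+-mono-≤ a<n a<n)

    ∸n-< : ∀ {c} → c < m → ¬ c < n → c ∸ n < n
    ∸n-< {c} c<m c≮n = ℕ.+-cancelʳ-< n (c ∸ n) n (subst (_< m) (sym (ℕ.m∸n+n≡m (ℕ.≮⇒≥ c≮n))) c<m)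

    ⌊/2⌋-< : ∀ {s} → s < m → ⌊ s /2⌋ < n
    ⌊/2⌋-< {s} s<m = s≤s (subst (⌊ s /2⌋ ≤_) (sym (ℕ.n≡⌈n+n/2⌉ p))
      (ℕ.⌊n/2⌋-mono (subst (s ≤_) (ℕ.+-suc p p) (ℕ.≤-pred s<m))))

  halve-< : ∀ {s} → s < m → halve s < m
  halve-< {s} s<m with parity≡0⊎1 s
  ... | inj₁ even = subst (λ k → ⌊ s /2⌋ + k * n < m) (sym even)
    (subst (_< m) (sym (ℕ.+-identityʳ ⌊ s /2⌋)) (ℕ.<-≤-trans (⌊/2⌋-< s<m) (ℕ.m≤m+n n n)))
  ... | inj₂ odd = subst (λ k → ⌊ s /2⌋ + k * n < m) (sym odd)
    (subst (λ k → ⌊ s /2⌋ + k < m) (sym (ℕ.+-identityʳ n)) (ℕ.+-monoˡ-< n (⌊/2⌋-< s<m)))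

  unhalve-< : ∀ {c} → c < m → unhalve c < m
  unhalve-< {c} c<m with c <? n
  ... | yes c<n = double-< c<n
  ... | no c≮n = suc-double-< (∸n-< c<m c≮n)

  halve-double : ∀ a → halve (a + a) ≡ a
  halve-double a = trans (cong₂ (λ h k → h + k * n) (sym (ℕ.n≡⌊n+n/2⌋ a)) (parity-double a)) (ℕ.+-identityʳ a)

  halve-unhalve : ∀ {c} → c < m → halve (unhalve c) ≡ c
  halve-unhalve {c} c<m with c <? n
  ... | yes _ = halve-double c
  ... | no c≮n = trans (cong₂ (λ h k → h + k * n) (sym (ℕ.n≡⌈n+n/2⌉ (c ∸ n))) (parity-suc-double (c ∸ n)))
                   (trans (cong ((c ∸ n) +_) (ℕ.+-identityʳ n)) (ℕ.m∸n+n≡m (ℕ.≮⇒≥ c≮n)))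

  unhalve-halve : ∀ {s} → s < m → unhalve (halve s) ≡ s
  unhalve-halve {s} s<m with parity≡0⊎1 s
  ... | inj₁ even = trans (cong unhalve halve≡) unhalve-low
    where
    halve≡ : halve s ≡ ⌊ s /2⌋
    halve≡ = trans (cong (λ k → ⌊ s /2⌋ + k * n) even) (ℕ.+-identityʳ ⌊ s /2⌋)
    unhalve-low : unhalve ⌊ s /2⌋ ≡ s
    unhalve-low with ⌊ s /2⌋ <? n
    ... | yes _ = even⇒⌊/2⌋+⌊/2⌋≡ s even
    ... | no ≮n = ⊥-elim (≮n (⌊/2⌋-< s<m))
  ... | inj₂ odd = trans (cong unhalve halve≡) unhalve-high
    where
    halve≡ : halve s ≡ ⌊ s /2⌋ + n
    halve≡ = trans (cong (λ k → ⌊ s /2⌋ + k * n) odd) (cong (⌊ s /2⌋ +_) (ℕ.+-identityʳ n))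
    unhalve-high : unhalve (⌊ s /2⌋ + n) ≡ s
    unhalve-high with ⌊ s /2⌋ + n <? n
    ... | yes <n = ⊥-elim (ℕ.<-irrefl refl (ℕ.≤-<-trans (ℕ.m≤n+m n ⌊ s /2⌋) <n))
    ... | no _ = trans (cong (λ h → suc (h + h)) (ℕ.m+n∸n≡m ⌊ s /2⌋ n)) (odd⇒suc[⌊/2⌋+⌊/2⌋]≡ s odd)

  infixl 7 _⋆_ _\\_
  _⋆_ : Fin m → Fin m → Fin m
  x ⋆ y = ⟦ halve ((toℕ x + toℕ y) % m) ⟧

  _\\_ : Fin m → Fin m → Fin m
  x \\ z = ⟦ unhalve (toℕ z) + (m ∸ toℕ x) ⟧

  ⋆-\\ : ∀ x z → x ⋆ (x \\ z) ≡ z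
  ⋆-\\ x z = trans (cong (λ s → ⟦ halve s ⟧) (trans (≈⇒%≡ sum≈) (m<n⇒m%n≡m (unhalve-< (toℕ<n z)))))
    (trans (cong ⟦_⟧ (halve-unhalve (toℕ<n z))) (⟦⟧-≈ ≈-refl))
    where
    X = toℕ x
    Z = toℕ z
    d = m ∸ X
    sum≈ : X + toℕ (x \\ z) ≈ unhalve Z
    sum≈ = begin
      X + toℕ (x \\ z)        ≈⟨ +-cong (≈-refl {X}) (toℕ-⟦⟧ (unhalve Z + d)) ⟩
      X + (unhalve Z + d)     ≡⟨ x∙yz≈y∙xz X (unhalve Z) d ⟩
      unhalve Z + (X + d)     ≡⟨ cong (unhalve Z +_) (toℕ+[m∸toℕ]≡m x) ⟩
      unhalve Z + m           ≈⟨ +-m (unhalve Z) ⟩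
      unhalve Z               ∎
      where open ≈-Reasoning

  \\-⋆ : ∀ x y → x \\ (x ⋆ y) ≡ y
  \\-⋆ x y = ⟦⟧-≈ (begin
    unhalve (toℕ (x ⋆ y)) + d  ≡⟨ cong (λ c → unhalve c + d) (toℕ-⟦⟧-< (halve-< S<m)) ⟩
    unhalve (halve S) + d      ≡⟨ cong (_+ d) (unhalve-halve S<m) ⟩
    S + d                      ≈⟨ +-cong (mk≈ (m%n%n≡m%n (X + Y) m)) (≈-refl {d}) ⟩
    X + Y + d                  ≡⟨ xy∙z≈y∙xz X Y d ⟩
    Y + (X + d)                ≡⟨ cong (Y +_) (toℕ+[m∸toℕ]≡m x) ⟩
    Y + m                      ≈⟨ +-m Y ⟩
    Y                          ∎)
    where
    open ≈-Reasoning
    X = toℕ x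
    Y = toℕ y
    S = (X + Y) % m
    S<m = m%n<n (X + Y) m
    d = m ∸ X

  isHigh : Fin m → Bool
  isHigh x = isYes (n ≤? toℕ x)

  high⇒n≤ : ∀ x → isHigh x ≡ true → n ≤ toℕ x
  high⇒n≤ x high = toWitness {a? = n ≤? toℕ x} (subst T (sym high) tt)

  low⇒<n : ∀ x → isHigh x ≡ false → toℕ x < n
  low⇒<n x low = ℕ.≰⇒> (toWitnessFalse {a? = n ≤? toℕ x} (subst (T ∘ not) (sym low) tt))

  partner : Fin m → Fin m
  partner x = ⟦ toℕ x + n ⟧

  toℕ-partner : ∀ x → toℕ x < n → toℕ (partner x) ≡ toℕ x + n
  toℕ-partner x x<n = toℕ-⟦⟧-< (ℕ.+-monoˡ-< n x<n)

  toℕ-⋆-self : ∀ x → toℕ (x ⋆ x) ≡ halve ((toℕ x + toℕ x) % m)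
  toℕ-⋆-self x = toℕ-⟦⟧-< (halve-< (m%n<n (toℕ x + toℕ x) m))

  square-low : ∀ x → toℕ x < n → toℕ (x ⋆ x) ≡ toℕ x
  square-low x x<n = trans (toℕ-⋆-self x) (trans (cong halve (m<n⇒m%n≡m (double-< x<n))) (halve-double (toℕ x)))

  square-high : ∀ x → n ≤ toℕ x → toℕ (x ⋆ x) ≡ toℕ x ∸ n
  square-high x n≤x = trans (toℕ-⋆-self x) (trans (cong halve [x+x]%m≡d+d) (halve-double d))
    where
    d = toℕ x ∸ n
    d<n : d < n
    d<n = ∸n-< (toℕ<n x) (ℕ.≤⇒≯ n≤x)
    [d+n]+[d+n]≡[d+d]+m : ∀ d n → (d + n) + (d + n) ≡ (d + d) + (n + n)
    [d+n]+[d+n]≡[d+d]+m = solve-∀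
    [x+x]%m≡d+d : (toℕ x + toℕ x) % m ≡ d + d
    [x+x]%m≡d+d = trans (cong (_% m) (trans (cong₂ _+_ x≡d+n x≡d+n) ([d+n]+[d+n]≡[d+d]+m d n)))
                        (trans (≈⇒%≡ (+-m (d + d))) (m<n⇒m%n≡m (double-< d<n)))
      where
      x≡d+n = sym (ℕ.m∸n+n≡m n≤x)

  n≤partner : ∀ x → toℕ x < n → n ≤ toℕ (partner x)
  n≤partner x x<n = subst (n ≤_) (sym (toℕ-partner x x<n)) (ℕ.m≤n+m n (toℕ x))

  high-square-low : ∀ x → isHigh x ≡ true → isHigh (x ⋆ x) ≡ false
  high-square-low x high = trans (isYes≗does (n ≤? toℕ (x ⋆ x))) (dec-false (n ≤? toℕ (x ⋆ x)) n≰x⋆x)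
    where
    n≤x = high⇒n≤ x high
    n≰x⋆x : ¬ n ≤ toℕ (x ⋆ x)
    n≰x⋆x = ℕ.<⇒≱ (subst (_< n) (sym (square-high x n≤x)) (∸n-< (toℕ<n x) (ℕ.≤⇒≯ n≤x)))

  partner-high : ∀ x → isHigh x ≡ false → isHigh (partner x) ≡ true
  partner-high x low =
    trans (isYes≗does (n ≤? toℕ (partner x))) (dec-true (n ≤? toℕ (partner x)) (n≤partner x (low⇒<n x low)))

  partner-square : ∀ x → isHigh x ≡ false → partner x ⋆ partner x ≡ x
  partner-square x low = toℕ-injective (begin
    toℕ (partner x ⋆ partner x) ≡⟨ square-high (partner x) (n≤partner x x<n) ⟩
    toℕ (partner x) ∸ n         ≡⟨ cong (_∸ n) (toℕ-partner x x<n) ⟩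
    toℕ x + n ∸ n               ≡⟨ ℕ.m+n∸n≡m (toℕ x) n ⟩
    toℕ x                       ∎)
    where
    open ≡-Reasoning
    x<n = low⇒<n x low

  square-partner : ∀ x → isHigh x ≡ true → partner (x ⋆ x) ≡ x
  square-partner x high =
    ⟦⟧-≈ {toℕ (x ⋆ x) + n} (mk≈ (cong (_% m) (trans (cong (_+ n) (square-high x n≤x)) (ℕ.m∸n+n≡m n≤x))))
    where
    n≤x = high⇒n≤ x high

  quasigroup : HalfIdempotentCommutativeQuasigroup (Fin m)
  quasigroup = record
    { _≟_ = _≟_ ; _⋆_ = _⋆_ ; _\\_ = _\\_
    ; comm = λ x y → cong (λ s → ⟦ halve (s % m) ⟧) (ℕ.+-comm (toℕ x) (toℕ y))
    ; leftDividesˡ = ⋆-\\ ; leftDividesʳ = \\-⋆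
    ; isHigh = isHigh ; partner = partner
    ; low-idem = λ x low → toℕ-injective (square-low x (low⇒<n x low))
    ; high-square-low = high-square-low ; partner-high = partner-high
    ; partner-square = partner-square ; square-partner = square-partner
    }


module Existence where

  open Isomorphisms
  open import Data.Nat using (zero; suc; _+_; _*_; _/_)
  open import Data.Nat.DivMod using (m≡m%n+[m/n]*n)
  open import Data.Nat.Tactic.RingSolver using (solve-∀)
  open import Data.Fin.Properties using (*↔×)
  open import Function.Properties.Inverse using (↔-trans)

  private
    empty : HalfIdempotentCommutativeQuasigroup (Fin 0)
    empty = record
      { _≟_ = λ () ; _⋆_ = λ () ; _\\_ = λ () ; comm = λ () ; leftDividesˡ = λ () ; leftDividesʳ = λ ()
      ; isHigh = λ () ; partner = λ () ; low-idem = λ () ; high-square-low = λ () ; partner-high = λ ()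
      ; partner-square = λ () ; square-partner = λ () }

    halfIdempotent : ∀ q → HalfIdempotentCommutativeQuasigroup (Fin (q + q))
    halfIdempotent zero = empty
    halfIdempotent (suc p) = CyclicEven.quasigroup p

    3+6q≡[2q+1]*3 : ∀ q → 3 + q * 6 ≡ suc (q + q) * 3
    3+6q≡[2q+1]*3 = solve-∀

    1+6q≡1+[q+q]*3 : ∀ q → 1 + q * 6 ≡ suc ((q + q) * 3)
    1+6q≡1+[q+q]*3 = solve-∀

  order-6q+3 : ∀ q → SteinerQuasigroup (Fin (suc (q + q) * 3))
  order-6q+3 q = Transport.quasigroup *↔× (Bose.quasigroup (CyclicOdd.quasigroup q))

  order-6q+1 : ∀ q → SteinerQuasigroup (Fin (suc ((q + q) * 3)))
  order-6q+1 q = Transport.quasigroup (↔-trans suc↔Maybe (Maybe-↔ *↔×)) (Skolem.quasigroup (halfIdempotent q))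

  steinerQuasigroup : ∀ w → Admissible w → SteinerQuasigroup (Fin w)
  steinerQuasigroup w (inj₁ w%6≡1) = subst (SteinerQuasigroup ∘ Fin) (sym w≡) (order-6q+1 (w / 6))
    where
    w≡ : w ≡ suc ((w / 6 + w / 6) * 3)
    w≡ = trans (m≡m%n+[m/n]*n w 6) (trans (cong (_+ w / 6 * 6) w%6≡1) (1+6q≡1+[q+q]*3 (w / 6)))
  steinerQuasigroup w (inj₂ w%6≡3) = subst (SteinerQuasigroup ∘ Fin) (sym w≡) (order-6q+3 (w / 6))
    where
    w≡ : w ≡ suc (w / 6 + w / 6) * 3
    w≡ = trans (m≡m%n+[m/n]*n w 6) (trans (cong (_+ w / 6 * 6) w%6≡3) (3+6q≡[2q+1]*3 (w / 6)))


module Sufficiency where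

  open Iteration
  open Existence
  open Arithmetic using (suc-%6⇒admissible)
  open import Data.Nat using (zero; suc; _+_; _*_; _^_; _∸_; _%_)
  open import Data.Nat.Properties using (suc-injective; +-comm; *-identityˡ)

  sufficiency : ∀ v t → (∃ λ k → v + 1 ≡ k * 2 ^ t × (k % 6 ≡ 2 ⊎ k % 6 ≡ 4)) →
    ∃ λ (B : List (Triple v)) → IsSTS B × AtLeastVeblen B (2 ^ t ∸ 1)
  sufficiency v t (zero , _ , inj₁ ())
  sufficiency v t (zero , _ , inj₂ ())
  sufficiency v t (suc w , v+1≡ , k%6) =
    ToSTS.blocks quasigroup , ToSTS.isSTS quasigroup ,
    veblenPoint , veblenPoint-injective , ToSTS.veblen quasigroup ∘ veblenPoint-isVeblen
    where
    order≡ : doublings t w ≡ v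
    order≡ = suc-injective (trans (suc-doublings t w) (trans (sym v+1≡) (+-comm v 1)))
    count≡ : doublings t 0 ≡ 2 ^ t ∸ 1
    count≡ = cong (_∸ 1) (trans (suc-doublings t 0) (*-identityˡ (2 ^ t)))
    open WithVeblenPoints (subst₂ WithVeblenPoints order≡ count≡
      (iterate-double t (noVeblenPoints (steinerQuasigroup w (suc-%6⇒admissible w k%6)))))


open import Data.Nat using (_<_; _+_; _*_; _^_; _∸_; _%_)
open Necessity using (necessity)
open Sufficiency using (sufficiency)

mainTheorem7 : ∀ (v t : ℕ) → 1 < v → Admissible v → 0 < t → (2 ^ t) ∸ 1 < v →
    (∃ λ (B : List (Triple v)) → IsSTS B × AtLeastVeblen B ((2 ^ t) ∸ 1))
    ⇔ (∃ λ (k : ℕ) → v + 1 ≡ k * 2 ^ t × ((k % 6 ≡ 2) ⊎ (k % 6 ≡ 4)))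
mainTheorem7 v t _ admissible _ 2^t∸1<v = mk⇔ (necessity v t admissible 2^t∸1<v) (sufficiency v t)
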